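{- Let $d$ be a positive integer, $k\ge2$ an integer and $r=k+1$. Let $V:=\{0,1,\dots,r\}^d$ and for $i=0,1,\dots,d$ let $V_i$ be the set of vectors in $V$ with exactly $i$ entries not in $\{0,r\}$. Then the image $W^k_dS^{k2^d}_r=\{W^k_dx : x\in S^{k2^d}_r\}$ equals $V\setminus V_0$; the set of vertices of ${\rm conv}(W^k_dS^{k2^d}_r)$ consists of those vectors $v\in V_1$ which have one entry equal to $1$ or $r-1$ and all other entries equal to $0$ or $r$; and therefore $u^k_r(d)=d2^d$.
   Context: For $n\ge r$, $S^n_r\subset\{0,1\}^n$ denotes the set of all $x\in\{0,1\}^n$ with exactly $r$ entries equal to $1$ (the uniform matroid). $W^k_d$ denotes the $d\times k2^d$ $\{0,1\}$-matrix whose $k2^d$ columns consist of exactly $k$ copies of each vector in $\{0,1\}^d$. $u^k_r(d)$ denotes the number of vertices of ${\rm conv}(W^k_dS^{k2^d}_r)$.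
   Formalization: The convex hull of $W^k_dS^{k2^d}_r$ and its vertices are taken in ℚ^d, so membership and extremality involve only rational convex combinations of rational points. -}

module Defs where

open import Data.Nat as ℕ using (ℕ; zero; suc; _∸_)
open import Data.Integer using (+_)
open import Data.Rational as ℚ using (ℚ; 0ℚ; 1ℚ; _/_)
open import Data.Bool using (Bool; true; false; if_then_else_; _∨_)
open import Relation.Nullary.Decidable using (does)
open import Data.Vec.Relation.Unary.All using () renaming (All to VAll)
open import Data.List as List using (List; []; _∷_; length; concatMap; replicate)
open import Data.List.Relation.Unary.All using (All)
open import Data.List.Relation.Unary.Unique.Propositional using (Unique)
open import Data.List.Membership.Propositional using (_∈_)
open import Data.Vec as Vec using (Vec; []; _∷_; toList)
open import Data.Fin using (Fin)
open import Data.Product using (Σ; ∃; ∃-syntax; _×_; _,_; proj₁; proj₂)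
open import Data.Sum using (_⊎_)
open import Relation.Binary.PropositionalEquality using (_≡_)
open import Relation.Nullary using (¬_)
open import Function.Bundles using (_⇔_)

-- The matrix W^k_d, given as the list of its k·2^d columns.

binVecs : (d : ℕ) → List (Vec ℕ d)
binVecs zero    = [] ∷ []
binVecs (suc d) = concatMap (λ v → (0 ∷ v) ∷ (1 ∷ v) ∷ []) (binVecs d)

Wcols : (k d : ℕ) → List (Vec ℕ d)
Wcols k d = concatMap (replicate k) (binVecs d)

ncols : (k d : ℕ) → ℕ
ncols k d = length (Wcols k d)

zeroV : {d : ℕ} → Vec ℕ d
zeroV = Vec.replicate _ 0

_+V_ : {d : ℕ} → Vec ℕ d → Vec ℕ d → Vec ℕ d
_+V_ = Vec.zipWith ℕ._+_

mulCols : {d : ℕ} → List (Vec ℕ d) → List Bool → Vec ℕ d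
mulCols []       _          = zeroV
mulCols (c ∷ cs) []         = zeroV
mulCols (c ∷ cs) (b ∷ bs)   = (if b then c else zeroV) +V mulCols cs bs

countTrue : {n : ℕ} → Vec Bool n → ℕ
countTrue []          = 0
countTrue (true ∷ v)  = suc (countTrue v)
countTrue (false ∷ v) = countTrue v

InS : (n r : ℕ) → Vec Bool n → Set
InS n r x = countTrue x ≡ r

W : (k d : ℕ) → Vec Bool (ncols k d) → Vec ℕ d
W k d x = mulCols (Wcols k d) (toList x)

InImage : (k d r : ℕ) → Vec ℕ d → Set
InImage k d r v = Σ (Vec Bool (ncols k d)) λ x → InS (ncols k d) r x × W k d x ≡ v

Extreme : ℕ → ℕ → Set
Extreme r a = (a ≡ 0) ⊎ (a ≡ r)

isExtreme : ℕ → ℕ → Bool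
isExtreme r a = does (a ℕ.≟ 0) ∨ does (a ℕ.≟ r)

countNonExtreme : {d : ℕ} → ℕ → Vec ℕ d → ℕ
countNonExtreme r []      = 0
countNonExtreme r (a ∷ v) = (if isExtreme r a then 0 else 1) ℕ.+ countNonExtreme r v

InV : (d r : ℕ) → Vec ℕ d → Set
InV d r v = VAll (ℕ._≤ r) v

InVi : (d r i : ℕ) → Vec ℕ d → Set
InVi d r i v = InV d r v × countNonExtreme r v ≡ i

VertexShape : (d r : ℕ) → Vec ℕ d → Set
VertexShape d r v =
  InVi d r 1 v × VAll (λ a → Extreme r a ⊎ (a ≡ 1 ⊎ a ≡ r ∸ 1)) v

-- Convex hulls and vertices in ℚ^d (all points involved are integral,
-- so working over ℚ instead of ℝ changes nothing).

ℕtoℚ : ℕ → ℚ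
ℕtoℚ n = + n / 1

embed : {d : ℕ} → Vec ℕ d → Vec ℚ d
embed = Vec.map ℕtoℚ

zeroQ : {d : ℕ} → Vec ℚ d
zeroQ = Vec.replicate _ 0ℚ

_+Q_ : {d : ℕ} → Vec ℚ d → Vec ℚ d → Vec ℚ d
_+Q_ = Vec.zipWith ℚ._+_

_·Q_ : {d : ℕ} → ℚ → Vec ℚ d → Vec ℚ d
t ·Q v = Vec.map (t ℚ.*_) v

sumWeights : {d : ℕ} → List (ℚ × Vec ℚ d) → ℚ
sumWeights []             = 0ℚ
sumWeights ((t , _) ∷ ps) = t ℚ.+ sumWeights ps

weightedSum : {d : ℕ} → List (ℚ × Vec ℚ d) → Vec ℚ d
weightedSum []             = zeroQ
weightedSum ((t , p) ∷ ps) = (t ·Q p) +Q weightedSum ps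

InConv : {d : ℕ} → (Vec ℚ d → Set) → Vec ℚ d → Set
InConv {d} P v =
  Σ (List (ℚ × Vec ℚ d)) λ ps →
    All (λ tp → 0ℚ ℚ.≤ proj₁ tp × P (proj₂ tp)) ps ×
    sumWeights ps ≡ 1ℚ × weightedSum ps ≡ v

IsVertex : {d : ℕ} → (Vec ℚ d → Set) → Vec ℚ d → Set
IsVertex P v =
  InConv P v ×
  (∀ a b t → InConv P a → InConv P b → 0ℚ ℚ.< t → t ℚ.< 1ℚ →
     v ≡ (t ·Q a) +Q ((1ℚ ℚ.- t) ·Q b) → a ≡ b)

HasCard : {d : ℕ} → (Vec ℚ d → Set) → ℕ → Set
HasCard {d} Q N =
  Σ (List (Vec ℚ d)) λ l → Unique l × (∀ v → (v ∈ l) ⇔ Q v) × length l ≡ N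

ImageQ : (k d r : ℕ) → Vec ℚ d → Set
ImageQ k d r v = Σ (Vec ℕ d) λ w → InImage k d r w × embed w ≡ v

-- u^k_r(d) = N : conv(W^k_d S^{k2^d}_r) has exactly N vertices
uEq : (k r d N : ℕ) → Set
uEq k r d N = HasCard (IsVertex (ImageQ k d r)) N

-- Reading x ∈ S^{k2^d}_r in blocks of k entries, one block for the k copies of each
-- u ∈ {0,1}^d, shows that W^k_d x = Σ m_u u with 0 ≤ m_u ≤ k and Σ m_u = r, and every such
-- multiset sum arises. Its entries are at most r, and it cannot lie in V₀ = {0,r}^d: there every
-- u with m_u > 0 would be the 0/1-pattern of v, forcing r ≤ k. Conversely v ∈ V ∖ V₀ is the sum
-- of its r level sets [v > t], t < r, and a coordinate with 1 ≤ v_i ≤ k shows that no u occurs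
-- more than k times among them.
--
-- A point of V ∖ V₀ not of the stated shape is the midpoint of two distinct points of V ∖ V₀
-- (shift a non-extreme entry by ±1), so it is not a vertex. A point w of the stated shape, whose
-- only non-extreme entry sits at j₀, is pinned down in the hull by the valid inequalities
-- g_j ≥ 0 (j ≠ j₀) and Σ_j g_j ≥ 1, which are tight at w; here g_j(x) is x_j or r − x_j,
-- chosen so that g_j(w) = 0 for j ≠ j₀ and g_{j₀}(w) = 1. Counting these shapes gives d·2^d.

module Submission where

open import Defs
open import Data.Nat as ℕ using (ℕ; zero; suc; z≤n; s≤s)
import Data.Nat.Properties as ℕP
open import Data.Bool using (Bool; true; false; if_then_else_)
open import Data.List as List using (List; []; _∷_; _++_; length; map; replicate; take; drop; concatMap; downFrom)
import Data.List.Properties as ListP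
open import Data.List.Relation.Unary.All as All using (All; []; _∷_)
import Data.List.Relation.Unary.All.Properties as AllP
open import Data.Vec as Vec using (Vec; []; _∷_; lookup; toList; fromList)
import Data.Vec.Properties as VecP
open import Data.Vec.Relation.Unary.All as VAll using () renaming (All to VAll; [] to []ᵛ; _∷_ to _∷ᵛ_)
import Data.Vec.Relation.Unary.All.Properties as VAllP
open import Data.Fin using (Fin; zero; suc)
open import Data.Product using (Σ; _×_; _,_; proj₁; proj₂; uncurry)
open import Function.Base using (_∘_)
open import Data.Sum as Sum using (_⊎_; inj₁; inj₂)
open import Relation.Nullary.Decidable using (_⊎-dec_)
open import Data.Bool.Properties using (T-≡; T-∨)
open import Function.Bundles using (Equivalence; _⇔_; mk⇔)
open import Data.Empty using (⊥-elim)
open import Relation.Binary.PropositionalEquality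
open import Relation.Nullary using (¬_; Dec; yes; no)
open import Algebra.Properties.CommutativeSemigroup ℕP.+-commutativeSemigroup
  using () renaming (interchange to +-interchange)

module Image where

  open import Data.Nat using (_+_; _*_; _∸_; _≤_; _<_; _⊓_)

  vecExt : ∀ {A : Set} {n} {u v : Vec A n} → (∀ i → lookup u i ≡ lookup v i) → u ≡ v
  vecExt {u = u} {v} h =
    trans (sym (VecP.tabulate∘lookup u)) (trans (VecP.tabulate-cong h) (VecP.tabulate∘lookup v))

  ∑ : {A : Set} → List A → (A → ℕ) → ℕ
  ∑ []       f = 0
  ∑ (x ∷ xs) f = f x + ∑ xs f

  infix 5 ∑
  syntax ∑ xs (λ x → e) = ∑[ x ∈ xs ] e

  module _ {A : Set} where

    ∑-cong : ∀ xs {f g : A → ℕ} → (∀ x → f x ≡ g x) → ∑ xs f ≡ ∑ xs g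
    ∑-cong []       h = refl
    ∑-cong (x ∷ xs) h = cong₂ _+_ (h x) (∑-cong xs h)

    ∑-mono-≤ : ∀ {xs} {f g : A → ℕ} → All (λ x → f x ≤ g x) xs → ∑ xs f ≤ ∑ xs g
    ∑-mono-≤ []          = z≤n
    ∑-mono-≤ (fx≤gx ∷ h) = ℕP.+-mono-≤ fx≤gx (∑-mono-≤ h)

    ∑≡0 : ∀ {xs} {f : A → ℕ} → ∑ xs f ≡ 0 → All (λ x → f x ≡ 0) xs
    ∑≡0 {[]}     _   = []
    ∑≡0 {x ∷ xs} eq = ℕP.m+n≡0⇒m≡0 _ eq ∷ ∑≡0 (ℕP.m+n≡0⇒n≡0 _ eq)

    ≤-pointwise∧∑≡⇒≡ : ∀ {xs} {f g : A → ℕ} → All (λ x → f x ≤ g x) xs → ∑ xs f ≡ ∑ xs g →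
                       All (λ x → f x ≡ g x) xs
    ≤-pointwise∧∑≡⇒≡ []          _  = []
    ≤-pointwise∧∑≡⇒≡ (fx≤gx ∷ h) eq with ℕP.m≤n⇒m<n∨m≡n fx≤gx
    ... | inj₂ fx≡gx =
      fx≡gx ∷ ≤-pointwise∧∑≡⇒≡ h (ℕP.+-cancelˡ-≡ _ _ _ (trans (cong (_+ _) (sym fx≡gx)) eq))
    ... | inj₁ fx<gx = ⊥-elim (ℕP.<-irrefl eq (ℕP.+-mono-<-≤ fx<gx (∑-mono-≤ h)))

    ∑-zero : (xs : List A) → ∑[ x ∈ xs ] 0 ≡ 0
    ∑-zero []       = refl
    ∑-zero (x ∷ xs) = ∑-zero xs

    ∑-+ : ∀ xs (f g : A → ℕ) → ∑[ x ∈ xs ] (f x + g x) ≡ ∑ xs f + ∑ xs g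
    ∑-+ []       f g = refl
    ∑-+ (x ∷ xs) f g =
      trans (cong (f x + g x +_) (∑-+ xs f g)) (+-interchange (f x) (g x) (∑ xs f) (∑ xs g))

    ∑-*ʳ : ∀ xs (f : A → ℕ) c → ∑[ x ∈ xs ] (f x * c) ≡ ∑ xs f * c
    ∑-*ʳ []       f c = refl
    ∑-*ʳ (x ∷ xs) f c =
      trans (cong (f x * c +_) (∑-*ʳ xs f c)) (sym (ℕP.*-distribʳ-+ c (f x) (∑ xs f)))

    ∑-comm : ∀ {B : Set} (xs : List A) (ys : List B) (f : A → B → ℕ) →
             ∑[ x ∈ xs ] ∑[ y ∈ ys ] f x y ≡ ∑[ y ∈ ys ] ∑[ x ∈ xs ] f x y
    ∑-comm xs []       f = ∑-zero xs
    ∑-comm xs (y ∷ ys) f =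
      trans (∑-+ xs (λ x → f x y) (λ x → ∑[ y′ ∈ ys ] f x y′))
            (cong ((∑[ x ∈ xs ] f x y) +_) (∑-comm xs ys f))

  ∑-one : ∀ {A : Set} (xs : List A) → ∑[ x ∈ xs ] 1 ≡ length xs
  ∑-one []       = refl
  ∑-one (x ∷ xs) = cong suc (∑-one xs)

  ∑-map : ∀ {A B : Set} (g : A → B) xs (f : B → ℕ) → ∑ (map g xs) f ≡ ∑[ x ∈ xs ] f (g x)
  ∑-map g []       f = refl
  ∑-map g (x ∷ xs) f = cong (f (g x) +_) (∑-map g xs f)

  IsBinary : ∀ {d} → Vec ℕ d → Set
  IsBinary = VAll (_≤ 1)

  binVecs-binary : ∀ d → All IsBinary (binVecs d)
  binVecs-binary zero    = []ᵛ ∷ []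
  binVecs-binary (suc d) = extend (binVecs-binary d)
    where
    extend : ∀ {B} → All IsBinary B → All IsBinary (concatMap (λ v → (0 ∷ v) ∷ (1 ∷ v) ∷ []) B)
    extend []       = []
    extend (b ∷ bs) = (z≤n ∷ᵛ b) ∷ (s≤s z≤n ∷ᵛ b) ∷ extend bs

  ∑-binVecs : ∀ d (f : Vec ℕ (suc d) → ℕ) →
              ∑ (binVecs (suc d)) f ≡ ∑[ v ∈ binVecs d ] (f (0 ∷ v) + f (1 ∷ v))
  ∑-binVecs d f = go (binVecs d)
    where
    go : ∀ B → ∑ (concatMap (λ v → (0 ∷ v) ∷ (1 ∷ v) ∷ []) B) f ≡ ∑[ v ∈ B ] (f (0 ∷ v) + f (1 ∷ v))
    go []      = refl
    go (v ∷ B) = trans (cong (λ s → f (0 ∷ v) + (f (1 ∷ v) + s)) (go B))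
                       (sym (ℕP.+-assoc (f (0 ∷ v)) (f (1 ∷ v)) _))

  δ : ∀ {d} → Vec ℕ d → Vec ℕ d → ℕ
  δ []      []      = 1
  δ (a ∷ u) (b ∷ v) = δ-head (a ℕ.≟ b) (δ u v)
    where
    δ-head : Dec (a ≡ b) → ℕ → ℕ
    δ-head (yes _) n = n
    δ-head (no _)  _ = 0

  δ-refl : ∀ {d} (u : Vec ℕ d) → δ u u ≡ 1
  δ-refl []      = refl
  δ-refl (a ∷ u) with a ℕ.≟ a
  ... | yes _  = δ-refl u
  ... | no a≢a = ⊥-elim (a≢a refl)

  δ-cases : ∀ {d} (u v : Vec ℕ d) → δ u v ≡ 0 ⊎ u ≡ v
  δ-cases []      []      = inj₂ refl
  δ-cases (a ∷ u) (b ∷ v) with a ℕ.≟ b | δ-cases u v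
  ... | no _     | _        = inj₁ refl
  ... | yes _    | inj₁ δ≡0 = inj₁ δ≡0
  ... | yes refl | inj₂ refl = inj₂ refl

  δ≤1 : ∀ {d} (u v : Vec ℕ d) → δ u v ≤ 1
  δ≤1 u v with δ-cases u v
  ... | inj₁ δ≡0 = ℕP.≤-trans (ℕP.≤-reflexive δ≡0) z≤n
  ... | inj₂ refl = ℕP.≤-reflexive (δ-refl u)

  δ-≢ : ∀ {d} (u v : Vec ℕ d) (i : Fin d) → lookup u i ≢ lookup v i → δ u v ≡ 0
  δ-≢ u v i uᵢ≢vᵢ with δ-cases u v
  ... | inj₁ δ≡0 = δ≡0
  ... | inj₂ refl = ⊥-elim (uᵢ≢vᵢ refl)

  δ-*-subst : ∀ {d} (u v : Vec ℕ d) (f : Vec ℕ d → ℕ) → δ u v * f u ≡ δ u v * f v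
  δ-*-subst u v f with δ-cases u v
  ... | inj₁ δ≡0 rewrite δ≡0 = refl
  ... | inj₂ refl = refl

  ∑-δ : ∀ {d} (c : Vec ℕ d) → IsBinary c → ∑[ u ∈ binVecs d ] δ u c ≡ 1
  ∑-δ []      []ᵛ              = refl
  ∑-δ (a ∷ c) (a≤1 ∷ᵛ c-binary) =
    trans (∑-binVecs _ (λ u → δ u (a ∷ c)))
          (trans (∑-cong (binVecs _) (split a≤1)) (∑-δ c c-binary))
    where
    split : ∀ {a} → a ≤ 1 → ∀ v → δ (0 ∷ v) (a ∷ c) + δ (1 ∷ v) (a ∷ c) ≡ δ v c
    split {0}     _ v = ℕP.+-identityʳ (δ v c)
    split {1}     _ v = refl
    split {suc (suc _)} (s≤s ()) v

  ∑-δ-sift : ∀ {d} (c : Vec ℕ d) → IsBinary c → (f : Vec ℕ d → ℕ) →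
             ∑[ u ∈ binVecs d ] (δ u c * f u) ≡ f c
  ∑-δ-sift c c-binary f = begin
    ∑[ u ∈ binVecs _ ] (δ u c * f u)  ≡⟨ ∑-cong (binVecs _) (λ u → δ-*-subst u c f) ⟩
    ∑[ u ∈ binVecs _ ] (δ u c * f c)  ≡⟨ ∑-*ʳ (binVecs _) (λ u → δ u c) (f c) ⟩
    (∑[ u ∈ binVecs _ ] δ u c) * f c  ≡⟨ cong (_* f c) (∑-δ c c-binary) ⟩
    1 * f c                           ≡⟨ ℕP.*-identityˡ (f c) ⟩
    f c                               ∎
    where open ≡-Reasoning

  trues : List Bool → ℕ
  trues []           = 0
  trues (true ∷ bs)  = suc (trues bs)
  trues (false ∷ bs) = trues bs

  trues-++ : ∀ bs cs → trues (bs ++ cs) ≡ trues bs + trues cs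
  trues-++ []           cs = refl
  trues-++ (true ∷ bs)  cs = cong suc (trues-++ bs cs)
  trues-++ (false ∷ bs) cs = trues-++ bs cs

  trues≤length : ∀ bs → trues bs ≤ length bs
  trues≤length []           = z≤n
  trues≤length (true ∷ bs)  = s≤s (trues≤length bs)
  trues≤length (false ∷ bs) = ℕP.m≤n⇒m≤1+n (trues≤length bs)

  countTrue≡trues : ∀ {n} (x : Vec Bool n) → countTrue x ≡ trues (toList x)
  countTrue≡trues []          = refl
  countTrue≡trues (true ∷ x)  = cong suc (countTrue≡trues x)
  countTrue≡trues (false ∷ x) = countTrue≡trues x

  selectSum : List ℕ → List Bool → ℕ
  selectSum []       _        = 0
  selectSum (c ∷ cs) []       = 0
  selectSum (c ∷ cs) (b ∷ bs) = (if b then c else 0) + selectSum cs bs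

  lookup-mulCols : ∀ {d} (cs : List (Vec ℕ d)) bs i →
                   lookup (mulCols cs bs) i ≡ selectSum (map (λ c → lookup c i) cs) bs
  lookup-mulCols []       bs           i = VecP.lookup-replicate i 0
  lookup-mulCols (c ∷ cs) []           i = VecP.lookup-replicate i 0
  lookup-mulCols (c ∷ cs) (true ∷ bs)  i =
    trans (VecP.lookup-zipWith _+_ i c _) (cong (lookup c i +_) (lookup-mulCols cs bs i))
  lookup-mulCols (c ∷ cs) (false ∷ bs) i =
    trans (VecP.lookup-zipWith _+_ i zeroV _)
          (cong₂ _+_ (VecP.lookup-replicate i 0) (lookup-mulCols cs bs i))

  take-++-length : ∀ {A : Set} (xs ys : List A) → take (length xs) (xs ++ ys) ≡ xs
  take-++-length []       ys = refl
  take-++-length (x ∷ xs) ys = cong (x ∷_) (take-++-length xs ys)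

  drop-++-length : ∀ {A : Set} (xs ys : List A) → drop (length xs) (xs ++ ys) ≡ ys
  drop-++-length []       ys = refl
  drop-++-length (x ∷ xs) ys = drop-++-length xs ys

  module Blocks {A : Set} (k : ℕ) where

    copies : List A → List A
    copies = concatMap (replicate k)

    length-copies : ∀ u B → length (copies (u ∷ B)) ≡ k + length (copies B)
    length-copies u B = trans (ListP.length-++ (replicate k u)) (cong (_+ _) (ListP.length-replicate k))

    blocks : List A → List Bool → List (ℕ × A)
    blocks []      bs = []
    blocks (u ∷ B) bs = (trues (take k bs) , u) ∷ blocks B (drop k bs)

    map-proj₂-blocks : ∀ B bs → map proj₂ (blocks B bs) ≡ B
    map-proj₂-blocks []      bs = refl
    map-proj₂-blocks (u ∷ B) bs = cong (u ∷_) (map-proj₂-blocks B (drop k bs))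

    blocks-bounded : ∀ B bs → All (λ p → proj₁ p ≤ k) (blocks B bs)
    blocks-bounded []      bs = []
    blocks-bounded (u ∷ B) bs =
      ℕP.≤-trans (trues≤length (take k bs))
                 (ℕP.≤-trans (ℕP.≤-reflexive (ListP.length-take k bs)) (ℕP.m⊓n≤m k _))
      ∷ blocks-bounded B (drop k bs)

    selectSum-replicate : ∀ m a cs bs →
      selectSum (replicate m a ++ cs) bs ≡ trues (take m bs) * a + selectSum cs (drop m bs)
    selectSum-replicate zero    a cs bs           = refl
    selectSum-replicate (suc m) a []       []           = refl
    selectSum-replicate (suc m) a (c ∷ cs) []           = refl
    selectSum-replicate (suc m) a cs       (true ∷ bs)  =
      trans (cong (a +_) (selectSum-replicate m a cs bs)) (sym (ℕP.+-assoc a _ _))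
    selectSum-replicate (suc m) a cs       (false ∷ bs) = selectSum-replicate m a cs bs

    selectSum-blocks : ∀ (g : A → ℕ) B bs →
      selectSum (map g (copies B)) bs ≡ ∑[ p ∈ blocks B bs ] proj₁ p * g (proj₂ p)
    selectSum-blocks g []      bs = refl
    selectSum-blocks g (u ∷ B) bs = begin
      selectSum (map g (replicate k u ++ copies B)) bs
        ≡⟨ cong (λ cs → selectSum cs bs) (ListP.map-++ g (replicate k u) (copies B)) ⟩
      selectSum (map g (replicate k u) ++ map g (copies B)) bs
        ≡⟨ cong (λ cs → selectSum (cs ++ map g (copies B)) bs) (ListP.map-replicate g k u) ⟩
      selectSum (replicate k (g u) ++ map g (copies B)) bs
        ≡⟨ selectSum-replicate k (g u) _ bs ⟩
      trues (take k bs) * g u + selectSum (map g (copies B)) (drop k bs)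
        ≡⟨ cong (trues (take k bs) * g u +_) (selectSum-blocks g B (drop k bs)) ⟩
      ∑[ p ∈ blocks (u ∷ B) bs ] proj₁ p * g (proj₂ p)
        ∎
      where open ≡-Reasoning

    trues-blocks : ∀ B bs → length bs ≡ length (copies B) →
                   trues bs ≡ ∑[ p ∈ blocks B bs ] proj₁ p
    trues-blocks []      []  _  = refl
    trues-blocks (u ∷ B) bs eq = begin
      trues bs                               ≡⟨ cong trues (sym (ListP.take++drop≡id k bs)) ⟩
      trues (take k bs ++ drop k bs)         ≡⟨ trues-++ (take k bs) (drop k bs) ⟩
      trues (take k bs) + trues (drop k bs)  ≡⟨ cong (trues (take k bs) +_) (trues-blocks B (drop k bs) eq′) ⟩
      ∑[ p ∈ blocks (u ∷ B) bs ] proj₁ p     ∎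
      where
      open ≡-Reasoning
      eq′ : length (drop k bs) ≡ length (copies B)
      eq′ = trans (ListP.length-drop k bs)
                  (trans (cong (_∸ k) (trans eq (length-copies u B))) (ℕP.m+n∸m≡n k _))

    block : ℕ → List Bool
    block m = replicate m true ++ replicate (k ∸ m) false

    fill : List (ℕ × A) → List Bool
    fill = concatMap (λ p → block (proj₁ p))

    module _ {m : ℕ} (m≤k : m ≤ k) where

      length-block : length (block m) ≡ k
      length-block = trans (ListP.length-++ (replicate m true))
        (trans (cong₂ _+_ (ListP.length-replicate m) (ListP.length-replicate (k ∸ m))) (ℕP.m+[n∸m]≡n m≤k))

      trues-block : trues (block m) ≡ m
      trues-block = trans (trues-++ (replicate m true) _)
                          (trans (cong₂ _+_ (all-true m) (all-false (k ∸ m))) (ℕP.+-identityʳ m))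
        where
        all-true : ∀ n → trues (replicate n true) ≡ n
        all-true zero    = refl
        all-true (suc n) = cong suc (all-true n)
        all-false : ∀ n → trues (replicate n false) ≡ 0
        all-false zero    = refl
        all-false (suc n) = all-false n

      take-block : ∀ bs → take k (block m ++ bs) ≡ block m
      take-block bs = subst (λ n → take n (block m ++ bs) ≡ block m) length-block (take-++-length (block m) bs)

      drop-block : ∀ bs → drop k (block m ++ bs) ≡ bs
      drop-block bs = subst (λ n → drop n (block m ++ bs) ≡ bs) length-block (drop-++-length (block m) bs)

    blocks-fill : ∀ ms → All (λ p → proj₁ p ≤ k) ms → blocks (map proj₂ ms) (fill ms) ≡ ms
    blocks-fill []             []          = refl
    blocks-fill ((m , u) ∷ ms) (m≤k ∷ ms≤k) = cong₂ _∷_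
      (cong (_, u) (trans (cong trues (take-block m≤k (fill ms))) (trues-block m≤k)))
      (trans (cong (blocks (map proj₂ ms)) (drop-block m≤k (fill ms))) (blocks-fill ms ms≤k))

    length-fill : ∀ ms → All (λ p → proj₁ p ≤ k) ms → length (fill ms) ≡ length (copies (map proj₂ ms))
    length-fill []             []           = refl
    length-fill ((m , u) ∷ ms) (m≤k ∷ ms≤k) =
      trans (ListP.length-++ (block m))
            (trans (cong₂ _+_ (length-block m≤k) (length-fill ms ms≤k)) (sym (length-copies u (map proj₂ ms))))

  record MultisetSum (k d r : ℕ) (v : Vec ℕ d) : Set where
    field
      terms    : List (ℕ × Vec ℕ d)
      columns  : map proj₂ terms ≡ binVecs d
      bounded  : All (λ p → proj₁ p ≤ k) terms
      total    : ∑[ p ∈ terms ] proj₁ p ≡ r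
      combines : ∀ i → ∑[ p ∈ terms ] proj₁ p * lookup (proj₂ p) i ≡ lookup v i

  module _ (k d r : ℕ) where
    open Blocks {Vec ℕ d} k

    countTrue-blocks : (x : Vec Bool (ncols k d)) →
                       countTrue x ≡ ∑[ p ∈ blocks (binVecs d) (toList x) ] proj₁ p
    countTrue-blocks x =
      trans (countTrue≡trues x) (trues-blocks (binVecs d) (toList x) (VecP.length-toList x))

    lookup-W-blocks : (x : Vec Bool (ncols k d)) (i : Fin d) →
      lookup (W k d x) i ≡ ∑[ p ∈ blocks (binVecs d) (toList x) ] proj₁ p * lookup (proj₂ p) i
    lookup-W-blocks x i =
      trans (lookup-mulCols (Wcols k d) (toList x) i) (selectSum-blocks (λ u → lookup u i) (binVecs d) (toList x))

    image⇒multisetSum : ∀ {v} → InImage k d r v → MultisetSum k d r v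
    image⇒multisetSum (x , count , product) = record
      { terms    = blocks (binVecs d) (toList x)
      ; columns  = map-proj₂-blocks (binVecs d) (toList x)
      ; bounded  = blocks-bounded (binVecs d) (toList x)
      ; total    = trans (sym (countTrue-blocks x)) count
      ; combines = λ i → trans (sym (lookup-W-blocks x i)) (cong (λ w → lookup w i) product)
      }

    multisetSum⇒image : ∀ {v} → MultisetSum k d r v → InImage k d r v
    multisetSum⇒image {v} s = x , count , vecExt product
      where
      open MultisetSum s
      length-fill-terms : length (fill terms) ≡ ncols k d
      length-fill-terms = trans (length-fill terms bounded) (cong (λ B → length (copies B)) columns)
      x : Vec Bool (ncols k d)
      x = Vec.cast length-fill-terms (fromList (fill terms))
      blocks-x : blocks (binVecs d) (toList x) ≡ terms
      blocks-x = begin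
        blocks (binVecs d) (toList x)          ≡⟨ cong (blocks (binVecs d)) (VecP.toList-cast _ (fromList (fill terms))) ⟩
        blocks (binVecs d) (toList (fromList (fill terms)))  ≡⟨ cong (blocks (binVecs d)) (VecP.toList∘fromList (fill terms)) ⟩
        blocks (binVecs d) (fill terms)        ≡⟨ cong (λ B → blocks B (fill terms)) (sym columns) ⟩
        blocks (map proj₂ terms) (fill terms)  ≡⟨ blocks-fill terms bounded ⟩
        terms                                  ∎
        where open ≡-Reasoning
      count : countTrue x ≡ r
      count = trans (countTrue-blocks x) (trans (cong (λ ps → ∑[ p ∈ ps ] proj₁ p) blocks-x) total)
      product : ∀ i → lookup (W k d x) i ≡ lookup v i
      product i = trans (lookup-W-blocks x i)
        (trans (cong (λ ps → ∑[ p ∈ ps ] proj₁ p * lookup (proj₂ p) i) blocks-x) (combines i))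

  module _ (r : ℕ) where

    Extreme? : ∀ a → Dec (Extreme r a)
    Extreme? a = a ℕ.≟ 0 ⊎-dec a ℕ.≟ r

    isExtreme⇒Extreme : ∀ {a} → isExtreme r a ≡ true → Extreme r a
    isExtreme⇒Extreme {a} e =
      Sum.map (ℕP.≡ᵇ⇒≡ a 0) (ℕP.≡ᵇ⇒≡ a r) (Equivalence.to T-∨ (Equivalence.from T-≡ e))

    Extreme⇒isExtreme : ∀ {a} → Extreme r a → isExtreme r a ≡ true
    Extreme⇒isExtreme {a} e =
      Equivalence.to T-≡ (Equivalence.from T-∨ (Sum.map (ℕP.≡⇒≡ᵇ a 0) (ℕP.≡⇒≡ᵇ a r) e))

    countNonExtreme-extreme : ∀ {d a} (v : Vec ℕ d) → Extreme r a →
                              countNonExtreme r (a ∷ v) ≡ countNonExtreme r v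
    countNonExtreme-extreme v e rewrite Extreme⇒isExtreme e = refl

    countNonExtreme-nonExtreme : ∀ {d} a (v : Vec ℕ d) → ¬ Extreme r a →
                                 countNonExtreme r (a ∷ v) ≡ suc (countNonExtreme r v)
    countNonExtreme-nonExtreme a v ¬e with isExtreme r a in eq
    ... | true  = ⊥-elim (¬e (isExtreme⇒Extreme eq))
    ... | false = refl

    allExtreme⇒countNonExtreme≡0 : ∀ {d} {v : Vec ℕ d} → VAll (Extreme r) v → countNonExtreme r v ≡ 0
    allExtreme⇒countNonExtreme≡0 []ᵛ                = refl
    allExtreme⇒countNonExtreme≡0 {v = _ ∷ v} (e ∷ᵛ es) =
      trans (countNonExtreme-extreme v e) (allExtreme⇒countNonExtreme≡0 es)

    countNonExtreme≡0⇒allExtreme : ∀ {d} (v : Vec ℕ d) → countNonExtreme r v ≡ 0 → VAll (Extreme r) v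
    countNonExtreme≡0⇒allExtreme []      _  = []ᵛ
    countNonExtreme≡0⇒allExtreme (a ∷ v) c with Extreme? a
    ... | yes e = e ∷ᵛ countNonExtreme≡0⇒allExtreme v (trans (sym (countNonExtreme-extreme v e)) c)
    ... | no ¬e = ⊥-elim (ℕP.1+n≢0 (trans (sym (countNonExtreme-nonExtreme a v ¬e)) c))

    nonExtreme-entry : ∀ {d} (v : Vec ℕ d) → countNonExtreme r v ≢ 0 → Σ (Fin d) λ i → ¬ Extreme r (lookup v i)
    nonExtreme-entry []      c≢0 = ⊥-elim (c≢0 refl)
    nonExtreme-entry (a ∷ v) c≢0 with Extreme? a
    ... | no ¬e = zero , ¬e
    ... | yes e = let (i , ¬eᵢ) = nonExtreme-entry v (λ c≡0 → c≢0 (trans (countNonExtreme-extreme v e) c≡0))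
                  in suc i , ¬eᵢ

    unique-nonExtreme-entry : ∀ {d} (v : Vec ℕ d) → countNonExtreme r v ≡ 1 →
      Σ (Fin d) λ j → ¬ Extreme r (lookup v j) × (∀ i → i ≢ j → Extreme r (lookup v i))
    unique-nonExtreme-entry []      ()
    unique-nonExtreme-entry (a ∷ v) c≡1 with Extreme? a
    ... | no ¬e = zero , ¬e , λ
      { zero i≢0    → ⊥-elim (i≢0 refl)
      ; (suc i) _   → VAllP.lookup⁺ (countNonExtreme≡0⇒allExtreme v
                         (ℕP.suc-injective (trans (sym (countNonExtreme-nonExtreme a v ¬e)) c≡1))) i }
    ... | yes e =
      let (j , ¬eⱼ , others) = unique-nonExtreme-entry v (trans (sym (countNonExtreme-extreme v e)) c≡1)
      in suc j , ¬eⱼ , λ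
        { zero _      → e
        ; (suc i) i≢j → others i (λ i≡j → i≢j (cong suc i≡j)) }

  nonExtreme-bounds : ∀ {k a} → a ≤ suc k → ¬ Extreme (suc k) a → 1 ≤ a × a ≤ k
  nonExtreme-bounds a≤r ¬e =
    ℕP.n≢0⇒n>0 (λ a≡0 → ¬e (inj₁ a≡0)) , ℕP.≤-pred (ℕP.≤∧≢⇒< a≤r (λ a≡r → ¬e (inj₂ a≡r)))

  χ< : ℕ → ℕ → ℕ
  χ< t a with t ℕ.<? a
  ... | yes _ = 1
  ... | no _  = 0

  χ<-yes : ∀ {t a} → t < a → χ< t a ≡ 1
  χ<-yes {t} {a} t<a with t ℕ.<? a
  ... | yes _   = refl
  ... | no t≮a = ⊥-elim (t≮a t<a)

  χ<-no : ∀ {t a} → ¬ t < a → χ< t a ≡ 0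
  χ<-no {t} {a} t≮a with t ℕ.<? a
  ... | yes t<a = ⊥-elim (t≮a t<a)
  ... | no _    = refl

  χ<≤1 : ∀ t a → χ< t a ≤ 1
  χ<≤1 t a with t ℕ.<? a
  ... | yes _ = ℕP.≤-refl
  ... | no _  = z≤n

  ∑-χ< : ∀ n a → ∑[ t ∈ downFrom n ] χ< t a ≡ n ⊓ a
  ∑-χ< zero    a = refl
  ∑-χ< (suc n) a with n ℕ.<? a
  ... | yes n<a = trans (cong suc (trans (∑-χ< n a) (ℕP.m≤n⇒m⊓n≡m (ℕP.<⇒≤ n<a))))
                        (sym (ℕP.m≤n⇒m⊓n≡m n<a))
  ... | no n≮a  = trans (∑-χ< n a) (trans (ℕP.m≥n⇒m⊓n≡n a≤n) (sym (ℕP.m≥n⇒m⊓n≡n (ℕP.m≤n⇒m≤1+n a≤n))))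
    where a≤n = ℕP.≮⇒≥ n≮a

  ∑-1∸χ< : ∀ n a → ∑[ t ∈ downFrom n ] (1 ∸ χ< t a) ≡ n ∸ a
  ∑-1∸χ< zero    a = sym (ℕP.0∸n≡0 a)
  ∑-1∸χ< (suc n) a with n ℕ.<? a
  ... | yes n<a = trans (trans (∑-1∸χ< n a) (ℕP.m≤n⇒m∸n≡0 (ℕP.<⇒≤ n<a))) (sym (ℕP.m≤n⇒m∸n≡0 n<a))
  ... | no n≮a  = trans (cong suc (∑-1∸χ< n a)) (sym (ℕP.+-∸-assoc 1 (ℕP.≮⇒≥ n≮a)))

  above : ∀ {d} → ℕ → Vec ℕ d → Vec ℕ d
  above t = Vec.map (χ< t)

  above-binary : ∀ {d} t (v : Vec ℕ d) → IsBinary (above t v)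
  above-binary t v = VAllP.map⁺ (VAll.universal (χ<≤1 t) v)

  ∑-above : ∀ {d} n (v : Vec ℕ d) i → lookup v i ≤ n → ∑[ t ∈ downFrom n ] lookup (above t v) i ≡ lookup v i
  ∑-above n v i vᵢ≤n = begin
    ∑[ t ∈ downFrom n ] lookup (above t v) i  ≡⟨ ∑-cong (downFrom n) (λ t → VecP.lookup-map i (χ< t) v) ⟩
    ∑[ t ∈ downFrom n ] χ< t (lookup v i)     ≡⟨ ∑-χ< n (lookup v i) ⟩
    n ⊓ lookup v i                            ≡⟨ ℕP.m≥n⇒m⊓n≡n vᵢ≤n ⟩
    lookup v i                                ∎
    where open ≡-Reasoning

  module Staircase (k : ℕ) where

    multiplicity : ∀ {d} → Vec ℕ d → Vec ℕ d → ℕ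
    multiplicity v u = ∑[ t ∈ downFrom (suc k) ] δ u (above t v)

    -- The level set above t has entry 1 at i iff t < vᵢ, so u equals at most vᵢ ≤ k of them
    -- if uᵢ = 1, and at most r ∸ vᵢ ≤ k of them otherwise.
    multiplicity≤k : ∀ {d} (v : Vec ℕ d) i → 1 ≤ lookup v i → lookup v i ≤ k → ∀ u → multiplicity v u ≤ k
    multiplicity≤k v i 1≤vᵢ vᵢ≤k u with lookup u i ℕ.≟ 1
    ... | yes uᵢ≡1 = begin
      multiplicity v u                  ≤⟨ ∑-mono-≤ (All.universal below (downFrom (suc k))) ⟩
      ∑[ t ∈ downFrom (suc k) ] χ< t a  ≡⟨ ∑-χ< (suc k) a ⟩
      suc k ⊓ a                         ≤⟨ ℕP.m⊓n≤n (suc k) a ⟩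
      a                                 ≤⟨ vᵢ≤k ⟩
      k                                 ∎
      where
      open ℕP.≤-Reasoning
      a = lookup v i
      below : ∀ t → δ u (above t v) ≤ χ< t a
      below t with t ℕ.<? a
      ... | yes _   = δ≤1 u (above t v)
      ... | no t≮a = ℕP.≤-reflexive (δ-≢ u (above t v) i λ uᵢ≡aboveᵢ →
                       ℕP.1+n≢0 (trans (sym uᵢ≡1) (trans uᵢ≡aboveᵢ
                         (trans (VecP.lookup-map i (χ< t) v) (χ<-no t≮a)))))
    ... | no uᵢ≢1 = begin
      multiplicity v u                          ≤⟨ ∑-mono-≤ (All.universal below (downFrom (suc k))) ⟩
      ∑[ t ∈ downFrom (suc k) ] (1 ∸ χ< t a)    ≡⟨ ∑-1∸χ< (suc k) a ⟩
      suc k ∸ a                                 ≤⟨ ℕP.∸-monoʳ-≤ (suc k) 1≤vᵢ ⟩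
      k                                         ∎
      where
      open ℕP.≤-Reasoning
      a = lookup v i
      below : ∀ t → δ u (above t v) ≤ 1 ∸ χ< t a
      below t with t ℕ.<? a
      ... | yes t<a = ℕP.≤-reflexive (δ-≢ u (above t v) i λ uᵢ≡aboveᵢ →
                        uᵢ≢1 (trans uᵢ≡aboveᵢ (trans (VecP.lookup-map i (χ< t) v) (χ<-yes t<a))))
      ... | no _    = δ≤1 u (above t v)

    staircase : ∀ {d} (v : Vec ℕ d) → InV d (suc k) v → countNonExtreme (suc k) v ≢ 0 →
                MultisetSum k d (suc k) v
    staircase {d} v v∈V c≢0 = record
      { terms    = map (λ u → multiplicity v u , u) B
      ; columns  = trans (sym (ListP.map-∘ B)) (ListP.map-id B)
      ; bounded  = AllP.map⁺ (All.universal (multiplicity≤k v i 1≤vᵢ vᵢ≤k) B)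
      ; total    = total
      ; combines = combines
      }
      where
      open ≡-Reasoning
      B = binVecs d
      ts = downFrom (suc k)
      i = proj₁ (nonExtreme-entry (suc k) v c≢0)
      bounds = nonExtreme-bounds (VAllP.lookup⁺ v∈V i) (proj₂ (nonExtreme-entry (suc k) v c≢0))
      1≤vᵢ = proj₁ bounds
      vᵢ≤k = proj₂ bounds
      total : ∑[ p ∈ map (λ u → multiplicity v u , u) B ] proj₁ p ≡ suc k
      total = begin
        ∑[ p ∈ map (λ u → multiplicity v u , u) B ] proj₁ p  ≡⟨ ∑-map _ B proj₁ ⟩
        ∑[ u ∈ B ] ∑[ t ∈ ts ] δ u (above t v)              ≡⟨ ∑-comm B ts (λ u t → δ u (above t v)) ⟩
        ∑[ t ∈ ts ] ∑[ u ∈ B ] δ u (above t v)              ≡⟨ ∑-cong ts (λ t → ∑-δ (above t v) (above-binary t v)) ⟩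
        ∑[ t ∈ ts ] 1                                       ≡⟨ ∑-one ts ⟩
        length ts                                           ≡⟨ ListP.length-downFrom (suc k) ⟩
        suc k                                               ∎
      combines : ∀ j → ∑[ p ∈ map (λ u → multiplicity v u , u) B ] proj₁ p * lookup (proj₂ p) j ≡ lookup v j
      combines j = begin
        ∑[ p ∈ map (λ u → multiplicity v u , u) B ] proj₁ p * lookup (proj₂ p) j
          ≡⟨ ∑-map _ B (λ p → proj₁ p * lookup (proj₂ p) j) ⟩
        ∑[ u ∈ B ] multiplicity v u * lookup u j
          ≡⟨ ∑-cong B (λ u → sym (∑-*ʳ ts (λ t → δ u (above t v)) (lookup u j))) ⟩
        ∑[ u ∈ B ] ∑[ t ∈ ts ] δ u (above t v) * lookup u j
          ≡⟨ ∑-comm B ts (λ u t → δ u (above t v) * lookup u j) ⟩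
        ∑[ t ∈ ts ] ∑[ u ∈ B ] δ u (above t v) * lookup u j
          ≡⟨ ∑-cong ts (λ t → ∑-δ-sift (above t v) (above-binary t v) (λ u → lookup u j)) ⟩
        ∑[ t ∈ ts ] lookup (above t v) j
          ≡⟨ ∑-above (suc k) v j (VAllP.lookup⁺ v∈V j) ⟩
        lookup v j
          ∎

  module _ {k d r : ℕ} {v : Vec ℕ d} (s : MultisetSum k d r v) where
    open MultisetSum s

    terms-binary : All (λ p → IsBinary (proj₂ p)) terms
    terms-binary = AllP.map⁻ (subst (All IsBinary) (sym columns) (binVecs-binary d))

    weight≤ : ∀ j {p : ℕ × Vec ℕ d} → IsBinary (proj₂ p) → proj₁ p * lookup (proj₂ p) j ≤ proj₁ p * 1
    weight≤ j {m , _} u-binary = ℕP.*-monoʳ-≤ m (VAllP.lookup⁺ u-binary j)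

    multisetSum⇒InV : InV d r v
    multisetSum⇒InV = VAllP.lookup⁻ λ j → begin
      lookup v j                                   ≡⟨ combines j ⟨
      ∑[ p ∈ terms ] proj₁ p * lookup (proj₂ p) j  ≤⟨ ∑-mono-≤ (All.map (λ {p} → weight≤ j {p}) terms-binary) ⟩
      ∑[ p ∈ terms ] proj₁ p * 1                   ≡⟨ ∑-cong terms (λ p → ℕP.*-identityʳ (proj₁ p)) ⟩
      ∑[ p ∈ terms ] proj₁ p                       ≡⟨ total ⟩
      r                                            ∎
      where open ℕP.≤-Reasoning

  module _ {k d : ℕ} {v : Vec ℕ d} (s : MultisetSum k d (suc k) v) where
    open MultisetSum s

    -- If every entry of v is 0 or r, each term with m > 0 is the 0/1-pattern c of v,
    -- which may be used at most k < r times.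
    multisetSum⇒¬allExtreme : ¬ VAll (Extreme (suc k)) v
    multisetSum⇒¬allExtreme extreme = ℕP.<-irrefl refl (begin-strict
      k                                          <⟨ ℕP.n<1+n k ⟩
      suc k                                      ≡⟨ total ⟨
      ∑[ p ∈ terms ] proj₁ p                     ≤⟨ ∑-mono-≤ (All.zipWith (uncurry term≤) (bounded , on-pattern)) ⟩
      ∑[ p ∈ terms ] δ (proj₂ p) c * k           ≡⟨ ∑-*ʳ terms (λ p → δ (proj₂ p) c) k ⟩
      (∑[ p ∈ terms ] δ (proj₂ p) c) * k         ≡⟨ cong (_* k) (sym (∑-map proj₂ terms (λ u → δ u c))) ⟩
      (∑[ u ∈ map proj₂ terms ] δ u c) * k       ≡⟨ cong (λ B → (∑[ u ∈ B ] δ u c) * k) columns ⟩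
      (∑[ u ∈ binVecs d ] δ u c) * k             ≡⟨ cong (_* k) (∑-δ c (above-binary 0 v)) ⟩
      1 * k                                      ≡⟨ ℕP.*-identityˡ k ⟩
      k                                          ∎)
      where
      open ℕP.≤-Reasoning
      c = above 0 v

      coordinate : ∀ j → All (λ p → proj₁ p * lookup (proj₂ p) j ≡ proj₁ p * lookup c j) terms
      coordinate j rewrite VecP.lookup-map j (χ< 0) v with VAllP.lookup⁺ extreme j
      ... | inj₁ vⱼ≡0 rewrite vⱼ≡0 =
        All.map (λ {p} e → trans e (sym (ℕP.*-zeroʳ (proj₁ p)))) (∑≡0 (trans (combines j) vⱼ≡0))
      ... | inj₂ vⱼ≡r rewrite vⱼ≡r = ≤-pointwise∧∑≡⇒≡
        (All.map (λ {p} → weight≤ s j {p}) (terms-binary s))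
        (trans (combines j) (trans vⱼ≡r (trans (sym total) (∑-cong terms (λ p → sym (ℕP.*-identityʳ (proj₁ p)))))))

      on-pattern : All (λ p → proj₁ p ≡ 0 ⊎ proj₂ p ≡ c) terms
      on-pattern = All.tabulate λ {p} p∈terms →
        zero-or-equal (proj₁ p) (proj₂ p) (λ j → All.lookup (coordinate j) p∈terms)
        where
        zero-or-equal : ∀ m u → (∀ j → m * lookup u j ≡ m * lookup c j) → m ≡ 0 ⊎ u ≡ c
        zero-or-equal zero    u _ = inj₁ refl
        zero-or-equal (suc m) u h = inj₂ (vecExt λ j → ℕP.*-cancelˡ-≡ _ _ (suc m) (h j))

      term≤ : ∀ {p} → proj₁ p ≤ k → proj₁ p ≡ 0 ⊎ proj₂ p ≡ c → proj₁ p ≤ δ (proj₂ p) c * k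
      term≤ _   (inj₁ m≡0) = ℕP.≤-trans (ℕP.≤-reflexive m≡0) z≤n
      term≤ {m , u} m≤k (inj₂ refl) = subst (m ≤_) (sym (trans (cong (_* k) (δ-refl u)) (ℕP.*-identityˡ k))) m≤k

  inImage⇔V∖V₀ : ∀ k {d} (v : Vec ℕ d) → InImage k d (suc k) v ⇔ (InV d (suc k) v × ¬ InVi d (suc k) 0 v)
  inImage⇔V∖V₀ k {d} v = mk⇔
    (λ img → let s = image⇒multisetSum k d (suc k) img in
      multisetSum⇒InV s , λ (_ , c≡0) → multisetSum⇒¬allExtreme s (countNonExtreme≡0⇒allExtreme (suc k) v c≡0))
    (λ (v∈V , v∉V₀) → multisetSum⇒image k d (suc k) (Staircase.staircase k v v∈V (λ c≡0 → v∉V₀ (v∈V , c≡0))))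

open Image

module Convexity where

  open import Data.Rational as ℚ using (ℚ; 0ℚ; 1ℚ; _+_; _*_; _-_; -_; _≤_; _<_; 1/_)
  import Data.Rational.Properties as ℚP
  open import Data.Rational.Solver using (module +-*-Solver)
  open import Algebra.Bundles using (Ring)
  open import Algebra.Properties.Semiring.Sum (Ring.semiring ℚP.+-*-ring)
    using (sum; sum-cong-≗; sum-replicate-zero; ∑-distrib-+; *-distribˡ-sum)
  open import Relation.Binary.Definitions using (tri<; tri≈; tri>)
  import Data.Fin.Properties as FinP
  open +-*-Solver using (solve; _:=_; _:+_; _:*_; _:-_; con)

  lookup-·Q : ∀ {d} t (p : Vec ℚ d) i → lookup (t ·Q p) i ≡ t * lookup p i
  lookup-·Q t p i = VecP.lookup-map i (t *_) p

  lookup-+Q : ∀ {d} (p q : Vec ℚ d) i → lookup (p +Q q) i ≡ lookup p i + lookup q i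
  lookup-+Q p q i = VecP.lookup-zipWith _+_ i p q

  lookup-zeroQ : ∀ {d} (i : Fin d) → lookup (zeroQ {d}) i ≡ 0ℚ
  lookup-zeroQ i = VecP.lookup-replicate i 0ℚ

  lookup-combination : ∀ {d} t s (p q : Vec ℚ d) i →
                       lookup ((t ·Q p) +Q (s ·Q q)) i ≡ t * lookup p i + s * lookup q i
  lookup-combination t s p q i =
    trans (lookup-+Q (t ·Q p) (s ·Q q) i) (cong₂ _+_ (lookup-·Q t p i) (lookup-·Q s q i))

  +Q-identityʳ : ∀ {d} (p : Vec ℚ d) → p +Q zeroQ ≡ p
  +Q-identityʳ = VecP.zipWith-identityʳ ℚP.+-identityʳ

  record IsLinear {d} (f : Vec ℚ d → ℚ) : Set where
    field
      map-zeroQ : f zeroQ ≡ 0ℚ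
      map-·Q+Q  : ∀ t p q → f ((t ·Q p) +Q q) ≡ t * f p + f q

    map-·Q : ∀ t p → f (t ·Q p) ≡ t * f p
    map-·Q t p = begin
      f (t ·Q p)              ≡⟨ cong f (+Q-identityʳ (t ·Q p)) ⟨
      f ((t ·Q p) +Q zeroQ)   ≡⟨ map-·Q+Q t p zeroQ ⟩
      t * f p + f zeroQ       ≡⟨ cong (t * f p +_) map-zeroQ ⟩
      t * f p + 0ℚ            ≡⟨ ℚP.+-identityʳ (t * f p) ⟩
      t * f p                 ∎
      where open ≡-Reasoning

    map-combination : ∀ t s p q → f ((t ·Q p) +Q (s ·Q q)) ≡ t * f p + s * f q
    map-combination t s p q = trans (map-·Q+Q t p (s ·Q q)) (cong (t * f p +_) (map-·Q s q))

  open IsLinear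

  lookup-isLinear : ∀ {d} (i : Fin d) → IsLinear (λ x → lookup x i)
  lookup-isLinear i = record
    { map-zeroQ = lookup-zeroQ i
    ; map-·Q+Q  = λ t p q → trans (lookup-+Q (t ·Q p) q i) (cong (_+ lookup q i) (lookup-·Q t p i))
    }

  *-isLinear : ∀ {d} c {f : Vec ℚ d → ℚ} → IsLinear f → IsLinear (λ x → c * f x)
  *-isLinear c {f} lin = record
    { map-zeroQ = trans (cong (c *_) (map-zeroQ lin)) (ℚP.*-zeroʳ c)
    ; map-·Q+Q  = λ t p q → trans (cong (c *_) (map-·Q+Q lin t p q))
        (solve 4 (λ c t x y → c :* (t :* x :+ y) := t :* (c :* x) :+ c :* y) refl c t (f p) (f q))
    }

  sum-isLinear : ∀ {d n} (h : Fin n → Vec ℚ d → ℚ) → (∀ j → IsLinear (h j)) →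
                 IsLinear (λ x → sum (λ j → h j x))
  sum-isLinear {n = n} h lin = record
    { map-zeroQ = trans (sum-cong-≗ (λ j → map-zeroQ (lin j))) (sum-replicate-zero n)
    ; map-·Q+Q  = λ t p q → begin
        sum (λ j → h j ((t ·Q p) +Q q))       ≡⟨ sum-cong-≗ (λ j → map-·Q+Q (lin j) t p q) ⟩
        sum (λ j → t * h j p + h j q)         ≡⟨ ∑-distrib-+ (λ j → t * h j p) (λ j → h j q) ⟩
        sum (λ j → t * h j p) + sum (λ j → h j q)  ≡⟨ cong (_+ sum (λ j → h j q)) (*-distribˡ-sum t (λ j → h j p)) ⟨
        t * sum (λ j → h j p) + sum (λ j → h j q)  ∎
    }
    where open ≡-Reasoning

  Weighted : ∀ {d} → (Vec ℚ d → Set) → ℚ × Vec ℚ d → Set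
  Weighted P (t , p) = 0ℚ ≤ t × P p

  weighted : ∀ {d} → (Vec ℚ d → ℚ) → List (ℚ × Vec ℚ d) → ℚ
  weighted f []             = 0ℚ
  weighted f ((t , p) ∷ ps) = t * f p + weighted f ps

  map-weightedSum : ∀ {d} {f : Vec ℚ d → ℚ} → IsLinear f → ∀ ps → f (weightedSum ps) ≡ weighted f ps
  map-weightedSum lin []             = map-zeroQ lin
  map-weightedSum {f = f} lin ((t , p) ∷ ps) =
    trans (map-·Q+Q lin t p (weightedSum ps)) (cong (t * f p +_) (map-weightedSum lin ps))

  weighted-+const : ∀ {d} (f : Vec ℚ d → ℚ) β ps →
                    weighted (λ p → f p + β) ps ≡ weighted f ps + β * sumWeights ps
  weighted-+const f β []             = solve 1 (λ β → con 0ℚ := con 0ℚ :+ β :* con 0ℚ) refl β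
  weighted-+const f β ((t , p) ∷ ps) = trans (cong (t * (f p + β) +_) (weighted-+const f β ps))
    (solve 5 (λ t x β y w → t :* (x :+ β) :+ (y :+ β :* w) := t :* x :+ y :+ β :* (t :+ w))
           refl t (f p) β (weighted f ps) (sumWeights ps))

  0≤* : ∀ {a b} → 0ℚ ≤ a → 0ℚ ≤ b → 0ℚ ≤ a * b
  0≤* {a} {b} 0≤a 0≤b = ℚP.nonNegative⁻¹ (a * b)
    {{ℚP.nonNeg*nonNeg⇒nonNeg a {{ℚ.nonNegative 0≤a}} b {{ℚ.nonNegative 0≤b}}}}

  0≤+ : ∀ {a b} → 0ℚ ≤ a → 0ℚ ≤ b → 0ℚ ≤ a + b
  0≤+ 0≤a 0≤b = ℚP.≤-trans (ℚP.≤-reflexive (sym (ℚP.+-identityʳ 0ℚ))) (ℚP.+-mono-≤ 0≤a 0≤b)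

  0≤weighted : ∀ {d} {P : Vec ℚ d → Set} {g : Vec ℚ d → ℚ} → (∀ p → P p → 0ℚ ≤ g p) →
               ∀ {ps} → All (Weighted P) ps → 0ℚ ≤ weighted g ps
  0≤weighted g≥0 []                 = ℚP.≤-refl
  0≤weighted g≥0 ((0≤t , Pp) ∷ wps) = 0≤+ (0≤* 0≤t (g≥0 _ Pp)) (0≤weighted g≥0 wps)

  0<1-t : ∀ {t} → t < 1ℚ → 0ℚ < 1ℚ - t
  0<1-t {t} t<1 = subst (_< 1ℚ - t) (ℚP.+-inverseʳ t) (ℚP.+-monoˡ-< (- t) t<1)

  0≤+≡0ˡ : ∀ {a b} → 0ℚ ≤ a → 0ℚ ≤ b → a + b ≡ 0ℚ → a ≡ 0ℚ
  0≤+≡0ˡ {a} 0≤a 0≤b a+b≡0 =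
    ℚP.≤-antisym (subst₂ _≤_ (ℚP.+-identityʳ a) a+b≡0 (ℚP.+-monoʳ-≤ a 0≤b)) 0≤a

  positive-combination≡0 : ∀ {t s x y} → 0ℚ < t → 0ℚ ≤ s → 0ℚ ≤ x → 0ℚ ≤ y →
                           t * x + s * y ≡ 0ℚ → x ≡ 0ℚ
  positive-combination≡0 {t} {s} {x} {y} 0<t 0≤s 0≤x 0≤y tx+sy≡0 =
    ℚP.≤-antisym (ℚP.≮⇒≥ λ 0<x → ℚP.<-irrefl (sym tx+sy≡0) (0<tx+sy 0<x)) 0≤x
    where
    0<tx+sy : 0ℚ < x → 0ℚ < t * x + s * y
    0<tx+sy 0<x = subst (_< t * x + s * y) (trans (cong (_+ 0ℚ) (ℚP.*-zeroʳ t)) (ℚP.+-identityʳ 0ℚ))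
      (ℚP.+-mono-<-≤ (ℚP.*-monoʳ-<-pos t {{ℚ.positive 0<t}} 0<x) (0≤* 0≤s 0≤y))

  sum-single : ∀ {n} (h : Fin n → ℚ) j → (∀ i → i ≢ j → h i ≡ 0ℚ) → sum h ≡ h j
  sum-single {suc n} h zero others = begin
    h zero + sum (λ i → h (suc i))  ≡⟨ cong (h zero +_) (sum-cong-≗ (λ i → others (suc i) λ ())) ⟩
    h zero + sum {n} (λ _ → 0ℚ)     ≡⟨ cong (h zero +_) (sum-replicate-zero n) ⟩
    h zero + 0ℚ                     ≡⟨ ℚP.+-identityʳ (h zero) ⟩
    h zero                          ∎
    where open ≡-Reasoning
  sum-single h (suc j) others = begin
    h zero + sum (λ i → h (suc i))  ≡⟨ cong (_+ sum (λ i → h (suc i))) (others zero λ ()) ⟩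
    0ℚ + sum (λ i → h (suc i))      ≡⟨ ℚP.+-identityˡ _ ⟩
    sum (λ i → h (suc i))           ≡⟨ sum-single (λ i → h (suc i)) j (λ i i≢j → others (suc i) (i≢j ∘ FinP.suc-injective)) ⟩
    h (suc j)                       ∎
    where open ≡-Reasoning

  0≤sum : ∀ {n} (h : Fin n → ℚ) → (∀ i → 0ℚ ≤ h i) → 0ℚ ≤ sum h
  0≤sum {zero}  h h≥0 = ℚP.≤-refl
  0≤sum {suc n} h h≥0 = 0≤+ (h≥0 zero) (0≤sum (λ i → h (suc i)) (λ i → h≥0 (suc i)))

  term≤sum : ∀ {n} (h : Fin n → ℚ) → (∀ i → 0ℚ ≤ h i) → ∀ j → h j ≤ sum h
  term≤sum h h≥0 zero    = subst (_≤ sum h) (ℚP.+-identityʳ (h zero))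
                             (ℚP.+-monoʳ-≤ (h zero) (0≤sum (λ i → h (suc i)) (λ i → h≥0 (suc i))))
  term≤sum h h≥0 (suc j) = ℚP.≤-trans (term≤sum (λ i → h (suc i)) (λ i → h≥0 (suc i)) j)
                             (subst (_≤ sum h) (ℚP.+-identityˡ _) (ℚP.+-monoˡ-≤ (sum (λ i → h (suc i))) (h≥0 zero)))

  module _ {d} {P : Vec ℚ d → Set} {f : Vec ℚ d → ℚ} (lin : IsLinear f) (β : ℚ)
           (valid : ∀ p → P p → 0ℚ ≤ f p + β) where

    valid-on-hull : ∀ {a} → InConv P a → 0ℚ ≤ f a + β
    valid-on-hull {a} (ps , wps , Σt≡1 , Σtp≡a) = subst (0ℚ ≤_) weighted≡ (0≤weighted valid wps)
      where
      weighted≡ : weighted (λ p → f p + β) ps ≡ f a + β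
      weighted≡ = begin
        weighted (λ p → f p + β) ps            ≡⟨ weighted-+const f β ps ⟩
        weighted f ps + β * sumWeights ps      ≡⟨ cong₂ (λ x w → x + β * w) (sym (map-weightedSum lin ps)) Σt≡1 ⟩
        f (weightedSum ps) + β * 1ℚ            ≡⟨ cong₂ _+_ (cong f Σtp≡a) (ℚP.*-identityʳ β) ⟩
        f a + β                                ∎
        where open ≡-Reasoning

    tight-face : ∀ {v a b t} → InConv P a → InConv P b → 0ℚ < t → t < 1ℚ →
                 v ≡ (t ·Q a) +Q ((1ℚ - t) ·Q b) → f v + β ≡ 0ℚ → f a + β ≡ 0ℚ × f b + β ≡ 0ℚ
    tight-face {v} {a} {b} {t} a∈hull b∈hull 0<t t<1 v≡ fv+β≡0 =
      positive-combination≡0 0<t (ℚP.<⇒≤ (0<1-t t<1)) fa+β≥0 fb+β≥0 combination≡0 ,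
      positive-combination≡0 (0<1-t t<1) (ℚP.<⇒≤ 0<t) fb+β≥0 fa+β≥0
        (trans (ℚP.+-comm ((1ℚ - t) * (f b + β)) (t * (f a + β))) combination≡0)
      where
      fa+β≥0 = valid-on-hull a∈hull
      fb+β≥0 = valid-on-hull b∈hull
      combination≡0 : t * (f a + β) + (1ℚ - t) * (f b + β) ≡ 0ℚ
      combination≡0 = begin
        t * (f a + β) + (1ℚ - t) * (f b + β)  ≡⟨ solve 4 (λ t x y β → t :* (x :+ β) :+ (con 1ℚ :- t) :* (y :+ β)
                                                    := t :* x :+ (con 1ℚ :- t) :* y :+ β) refl t (f a) (f b) β ⟩
        t * f a + (1ℚ - t) * f b + β          ≡⟨ cong (_+ β) (map-combination lin t (1ℚ - t) a b) ⟨
        f ((t ·Q a) +Q ((1ℚ - t) ·Q b)) + β   ≡⟨ cong (λ x → f x + β) v≡ ⟨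
        f v + β                               ≡⟨ fv+β≡0 ⟩
        0ℚ                                    ∎
        where open ≡-Reasoning

  0ℚ·Q : ∀ {d} (p : Vec ℚ d) → 0ℚ ·Q p ≡ zeroQ
  0ℚ·Q p = vecExt λ i → trans (lookup-·Q 0ℚ p i) (trans (ℚP.*-zeroˡ (lookup p i)) (sym (lookup-zeroQ i)))

  ·Q-zeroQ : ∀ {d} c → c ·Q zeroQ {d} ≡ zeroQ
  ·Q-zeroQ c = vecExt λ i →
    trans (lookup-·Q c zeroQ i) (trans (cong (c *_) (lookup-zeroQ i)) (trans (ℚP.*-zeroʳ c) (sym (lookup-zeroQ i))))

  1ℚ·Q : ∀ {d} (p : Vec ℚ d) → 1ℚ ·Q p ≡ p
  1ℚ·Q p = trans (VecP.map-cong ℚP.*-identityˡ p) (VecP.map-id p)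

  +Q-identityˡ : ∀ {d} (p : Vec ℚ d) → zeroQ +Q p ≡ p
  +Q-identityˡ = VecP.zipWith-identityˡ ℚP.+-identityˡ

  convex-idem : ∀ {d} t (p : Vec ℚ d) → (t ·Q p) +Q ((1ℚ - t) ·Q p) ≡ p
  convex-idem t p = vecExt λ i → trans (lookup-combination t (1ℚ - t) p p i)
    (solve 2 (λ t x → t :* x :+ (con 1ℚ :- t) :* x := x) refl t (lookup p i))

  member⇒InConv : ∀ {d} {P : Vec ℚ d → Set} {p} → P p → InConv P p
  member⇒InConv {p = p} Pp =
    (1ℚ , p) ∷ [] , (ℚP.<⇒≤ (ℚP.positive⁻¹ 1ℚ) , Pp) ∷ [] , ℚP.+-identityʳ 1ℚ ,
    trans (+Q-identityʳ (1ℚ ·Q p)) (1ℚ·Q p)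

  module _ {d} {P : Vec ℚ d → Set} where

    0≤sumWeights : ∀ {ps} → All (Weighted P) ps → 0ℚ ≤ sumWeights ps
    0≤sumWeights []               = ℚP.≤-refl
    0≤sumWeights ((0≤t , _) ∷ wps) = 0≤+ 0≤t (0≤sumWeights wps)

    weightedSum-zero : ∀ {ps} → All (Weighted P) ps → sumWeights ps ≡ 0ℚ → weightedSum ps ≡ zeroQ
    weightedSum-zero []                               _     = refl
    weightedSum-zero {(t , p) ∷ ps} ((0≤t , _) ∷ wps) t+s≡0 = begin
      (t ·Q p) +Q weightedSum ps   ≡⟨ cong₂ (λ t w → (t ·Q p) +Q w) t≡0 (weightedSum-zero wps s≡0) ⟩
      (0ℚ ·Q p) +Q zeroQ           ≡⟨ +Q-identityʳ (0ℚ ·Q p) ⟩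
      0ℚ ·Q p                      ≡⟨ 0ℚ·Q p ⟩
      zeroQ                        ∎
      where
      open ≡-Reasoning
      0≤s = 0≤sumWeights wps
      t≡0 : t ≡ 0ℚ
      t≡0 = 0≤+≡0ˡ 0≤t 0≤s t+s≡0
      s≡0 : sumWeights ps ≡ 0ℚ
      s≡0 = 0≤+≡0ˡ 0≤s 0≤t (trans (ℚP.+-comm _ t) t+s≡0)

    scaleWeights : ℚ → List (ℚ × Vec ℚ d) → List (ℚ × Vec ℚ d)
    scaleWeights c = map (λ (t , p) → c * t , p)

    sumWeights-scale : ∀ c ps → sumWeights (scaleWeights c ps) ≡ c * sumWeights ps
    sumWeights-scale c []             = sym (ℚP.*-zeroʳ c)
    sumWeights-scale c ((t , p) ∷ ps) =
      trans (cong (c * t +_) (sumWeights-scale c ps)) (sym (ℚP.*-distribˡ-+ c t (sumWeights ps)))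

    weightedSum-scale : ∀ c ps → weightedSum (scaleWeights c ps) ≡ c ·Q weightedSum ps
    weightedSum-scale c []             = sym (·Q-zeroQ c)
    weightedSum-scale c ((t , p) ∷ ps) = vecExt λ i → begin
      lookup (((c * t) ·Q p) +Q weightedSum (scaleWeights c ps)) i
        ≡⟨ lookup-+Q ((c * t) ·Q p) _ i ⟩
      lookup ((c * t) ·Q p) i + lookup (weightedSum (scaleWeights c ps)) i
        ≡⟨ cong₂ _+_ (lookup-·Q (c * t) p i) (cong (λ w → lookup w i) (weightedSum-scale c ps)) ⟩
      c * t * lookup p i + lookup (c ·Q weightedSum ps) i
        ≡⟨ cong (c * t * lookup p i +_) (lookup-·Q c (weightedSum ps) i) ⟩
      c * t * lookup p i + c * lookup (weightedSum ps) i
        ≡⟨ solve 4 (λ c t x w → c :* t :* x :+ c :* w := c :* (t :* x :+ w)) refl c t (lookup p i) _ ⟩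
      c * (t * lookup p i + lookup (weightedSum ps) i)
        ≡⟨ cong (c *_) (sym (trans (lookup-+Q (t ·Q p) (weightedSum ps) i) (cong (_+ _) (lookup-·Q t p i)))) ⟩
      c * lookup ((t ·Q p) +Q weightedSum ps) i
        ≡⟨ lookup-·Q c ((t ·Q p) +Q weightedSum ps) i ⟨
      lookup (c ·Q ((t ·Q p) +Q weightedSum ps)) i
        ∎
      where open ≡-Reasoning

    normalise : ∀ {ps s} → All (Weighted P) ps → 0ℚ < s → sumWeights ps ≡ s →
                Σ (Vec ℚ d) λ b → InConv P b × weightedSum ps ≡ s ·Q b
    normalise {ps} {s} wps 0<s Σt≡s =
      weightedSum qs , (qs , scaled wps , Σqs≡1 , refl) , sym s·b≡
      where
      instance
        s≢0 : ℚ.NonZero s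
        s≢0 = ℚP.pos⇒nonZero s {{ℚ.positive 0<s}}
      qs = scaleWeights (1/ s) ps
      0≤1/s : 0ℚ ≤ 1/ s
      0≤1/s = ℚP.<⇒≤ (ℚP.positive⁻¹ (1/ s) {{ℚP.1/pos⇒pos s {{ℚ.positive 0<s}}}})
      scaled : ∀ {ps} → All (Weighted P) ps → All (Weighted P) (scaleWeights (1/ s) ps)
      scaled []                = []
      scaled ((0≤t , Pp) ∷ wps) = (0≤* 0≤1/s 0≤t , Pp) ∷ scaled wps
      Σqs≡1 : sumWeights qs ≡ 1ℚ
      Σqs≡1 = trans (sumWeights-scale (1/ s) ps) (trans (cong (1/ s *_) Σt≡s) (ℚP.*-inverseˡ s))
      s·b≡ : s ·Q weightedSum qs ≡ weightedSum ps
      s·b≡ = begin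
        s ·Q weightedSum qs                      ≡⟨ cong (s ·Q_) (weightedSum-scale (1/ s) ps) ⟩
        s ·Q ((1/ s) ·Q weightedSum ps)          ≡⟨ VecP.map-∘ (s *_) (1/ s *_) (weightedSum ps) ⟨
        Vec.map (λ x → s * (1/ s * x)) (weightedSum ps)  ≡⟨ VecP.map-cong cancel (weightedSum ps) ⟩
        Vec.map (λ x → x) (weightedSum ps)       ≡⟨ VecP.map-id (weightedSum ps) ⟩
        weightedSum ps                           ∎
        where
        open ≡-Reasoning
        cancel : ∀ x → s * (1/ s * x) ≡ x
        cancel x = trans (sym (ℚP.*-assoc s (1/ s) x))
                         (trans (cong (_* x) (ℚP.*-inverseʳ s)) (ℚP.*-identityˡ x))

    first-weight-one : ∀ {t p ps} → All (Weighted P) ps → t ≡ 1ℚ → t + sumWeights ps ≡ 1ℚ →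
                       (t ·Q p) +Q weightedSum ps ≡ p
    first-weight-one {t} {p} {ps} wps t≡1 t+s≡1 = begin
      (t ·Q p) +Q weightedSum ps   ≡⟨ cong₂ (λ t w → (t ·Q p) +Q w) t≡1 (weightedSum-zero wps s≡0) ⟩
      (1ℚ ·Q p) +Q zeroQ           ≡⟨ +Q-identityʳ (1ℚ ·Q p) ⟩
      1ℚ ·Q p                      ≡⟨ 1ℚ·Q p ⟩
      p                            ∎
      where
      open ≡-Reasoning
      s≡0 : sumWeights ps ≡ 0ℚ
      s≡0 = trans (solve 2 (λ t s → s := t :+ s :- t) refl t _) (trans (cong₂ _-_ t+s≡1 t≡1) (ℚP.+-inverseʳ 1ℚ))

    first-weight-zero : ∀ {t p} (ps : List (ℚ × Vec ℚ d)) → t ≡ 0ℚ → (t ·Q p) +Q weightedSum ps ≡ weightedSum ps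
    first-weight-zero {p = p} ps t≡0 =
      trans (cong (_+Q weightedSum ps) (trans (cong (_·Q p) t≡0) (0ℚ·Q p))) (+Q-identityˡ _)

    vertex⇒member : ∀ {v} → IsVertex P v → P v
    vertex⇒member {v} ((ps , wps , Σt≡1 , Σtp≡v) , extreme) = go wps Σt≡1 Σtp≡v
      where
      go : ∀ {ps} → All (Weighted P) ps → sumWeights ps ≡ 1ℚ → weightedSum ps ≡ v → P v
      go [] 0≡1 _ = ⊥-elim (ℚP.1≢0 (sym 0≡1))
      go {(t , p) ∷ ps} ((0≤t , Pp) ∷ wps) t+s≡1 tp+w≡v with ℚP.<-cmp t 1ℚ | ℚP.<-cmp 0ℚ t
      ... | tri> _ _ t>1 | _ = ⊥-elim (ℚP.<-irrefl (sym t+s≡1) (ℚP.<-≤-trans t>1 t≤t+s))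
        where
        t≤t+s = subst (_≤ t + sumWeights ps) (ℚP.+-identityʳ t) (ℚP.+-monoʳ-≤ t (0≤sumWeights wps))
      ... | tri≈ _ t≡1 _ | _ = subst P (trans (sym (first-weight-one wps t≡1 t+s≡1)) tp+w≡v) Pp
      ... | tri< _ _ _ | tri> _ _ t<0 = ⊥-elim (ℚP.<-irrefl refl (ℚP.<-≤-trans t<0 0≤t))
      ... | tri< _ _ _ | tri≈ _ 0≡t _ =
        go wps (trans (sym (ℚP.+-identityˡ _)) (trans (cong (_+ sumWeights ps) 0≡t) t+s≡1))
               (trans (sym (first-weight-zero ps (sym 0≡t))) tp+w≡v)
      ... | tri< t<1 _ _ | tri< 0<t _ _ = subst P p≡v Pp
        where
        s≡1-t : sumWeights ps ≡ 1ℚ - t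
        s≡1-t = trans (solve 2 (λ t s → s := t :+ s :- t) refl t _) (cong (_- t) t+s≡1)
        normalised = normalise wps (0<1-t t<1) s≡1-t
        b = proj₁ normalised
        b∈hull = proj₁ (proj₂ normalised)
        v≡tp+[1-t]b : v ≡ (t ·Q p) +Q ((1ℚ - t) ·Q b)
        v≡tp+[1-t]b = trans (sym tp+w≡v) (cong ((t ·Q p) +Q_) (proj₂ (proj₂ normalised)))
        p≡v : p ≡ v
        p≡v = sym (begin
          v                               ≡⟨ v≡tp+[1-t]b ⟩
          (t ·Q p) +Q ((1ℚ - t) ·Q b)     ≡⟨ cong (λ b → (t ·Q p) +Q ((1ℚ - t) ·Q b)) p≡b ⟨
          (t ·Q p) +Q ((1ℚ - t) ·Q p)     ≡⟨ convex-idem t p ⟩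
          p                               ∎)
          where
          open ≡-Reasoning
          p≡b = extreme p b t (member⇒InConv Pp) b∈hull 0<t t<1 v≡tp+[1-t]b

open Convexity

module Vertices where

  open import Data.Rational as ℚ using (ℚ; 0ℚ; 1ℚ; mkℚ; _+_; _*_; _-_; -_; _≤_; _<_; ½)
  import Data.Rational.Properties as ℚP
  open import Data.Rational.Solver using (module +-*-Solver)
  open +-*-Solver using (solve; _:=_; _:+_; _:*_; _:-_; con)
  import Data.Integer as ℤ
  import Data.Integer.Properties as ℤP
  import Data.Nat.Coprimality as Coprime
  open import Relation.Nullary.Decidable using (toWitness)
  import Data.Fin.Properties as FinP
  open import Algebra.Bundles using (Ring)
  open import Algebra.Properties.Semiring.Sum (Ring.semiring ℚP.+-*-ring) using (sum; ∑-distrib-+)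

  ℕtoℚ≡mkℚ : ∀ n → ℕtoℚ n ≡ mkℚ (ℤ.+ n) 0 (Coprime.sym (Coprime.1-coprimeTo n))
  ℕtoℚ≡mkℚ n = ℚP.↥p/↧p≡p _

  ℕtoℚ-+ : ∀ m n → ℕtoℚ (m ℕ.+ n) ≡ ℕtoℚ m + ℕtoℚ n
  ℕtoℚ-+ m n rewrite ℕtoℚ≡mkℚ m | ℕtoℚ≡mkℚ n =
    ℚP./-cong {p₁ = ℤ.+ (m ℕ.+ n)} {q₁ = 1} (sym (cong₂ ℤ._+_ (ℤP.*-identityʳ (ℤ.+ m)) (ℤP.*-identityʳ (ℤ.+ n)))) refl

  ℕtoℚ-injective : ∀ {m n} → ℕtoℚ m ≡ ℕtoℚ n → m ≡ n
  ℕtoℚ-injective {m} {n} eq = ℤP.+-injective (cong ℚ.↥_ (trans (sym (ℕtoℚ≡mkℚ m)) (trans eq (ℕtoℚ≡mkℚ n))))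

  ℕtoℚ-mono-≤ : ∀ {m n} → m ℕ.≤ n → ℕtoℚ m ≤ ℕtoℚ n
  ℕtoℚ-mono-≤ {m} {n} m≤n rewrite ℕtoℚ≡mkℚ m | ℕtoℚ≡mkℚ n =
    ℚ.*≤* (subst₂ ℤ._≤_ (sym (ℤP.*-identityʳ (ℤ.+ m))) (sym (ℤP.*-identityʳ (ℤ.+ n))) (ℤ.+≤+ m≤n))

  0≤ℕtoℚ : ∀ n → 0ℚ ≤ ℕtoℚ n
  0≤ℕtoℚ n = ℕtoℚ-mono-≤ {0} {n} z≤n

  ℕtoℚ-∸ : ∀ {m n} → n ℕ.≤ m → ℕtoℚ (m ℕ.∸ n) ≡ ℕtoℚ m - ℕtoℚ n
  ℕtoℚ-∸ {m} {n} n≤m = begin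
    ℕtoℚ (m ℕ.∸ n)                     ≡⟨ solve 2 (λ a b → a := a :+ b :- b) refl (ℕtoℚ (m ℕ.∸ n)) (ℕtoℚ n) ⟩
    ℕtoℚ (m ℕ.∸ n) + ℕtoℚ n - ℕtoℚ n   ≡⟨ cong (_- ℕtoℚ n) (ℕtoℚ-+ (m ℕ.∸ n) n) ⟨
    ℕtoℚ (m ℕ.∸ n ℕ.+ n) - ℕtoℚ n      ≡⟨ cong (λ a → ℕtoℚ a - ℕtoℚ n) (ℕP.m∸n+n≡m n≤m) ⟩
    ℕtoℚ m - ℕtoℚ n                    ∎
    where open ≡-Reasoning

  lookup-embed : ∀ {d} (w : Vec ℕ d) i → lookup (embed w) i ≡ ℕtoℚ (lookup w i)
  lookup-embed w i = VecP.lookup-map i ℕtoℚ w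

  embed-injective : ∀ {d} {u v : Vec ℕ d} → embed u ≡ embed v → u ≡ v
  embed-injective {u = u} {v} eq = vecExt λ i →
    ℕtoℚ-injective (trans (sym (lookup-embed u i)) (trans (cong (λ x → lookup x i) eq) (lookup-embed v i)))

  data End : Set where
    bottom top : End

  module Polytope (k : ℕ) where

    r : ℕ
    r = suc k

    NonCorner : ∀ {d} → Vec ℕ d → Set
    NonCorner {d} u = InV d r u × countNonExtreme r u ≢ 0

    record Midpoint {d} (w : Vec ℕ d) : Set where
      field
        left right : Vec ℕ d
        left∈      : NonCorner left
        right∈     : NonCorner right
        distinct   : left ≢ right
        sums       : ∀ i → lookup left i ℕ.+ lookup right i ≡ lookup w i ℕ.+ lookup w i

    inner⇒¬Extreme : ∀ {a} → 1 ℕ.≤ a → a ℕ.≤ k → ¬ Extreme r a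
    inner⇒¬Extreme 1≤a a≤k (inj₁ refl) = ℕP.<-irrefl refl 1≤a
    inner⇒¬Extreme 1≤a a≤k (inj₂ refl) = ℕP.<-irrefl refl a≤k

    nonCorner-∷ : ∀ {d a} {w : Vec ℕ d} → a ℕ.≤ r → NonCorner w → NonCorner (a ∷ w)
    nonCorner-∷ {a = a} {w} a≤r (w∈V , c≢0) = a≤r ∷ᵛ w∈V , λ c≡0 → c≢0 (tail≡0 c≡0)
      where
      tail≡0 : countNonExtreme r (a ∷ w) ≡ 0 → countNonExtreme r w ≡ 0
      tail≡0 c≡0 with Extreme? r a
      ... | yes e = trans (sym (countNonExtreme-extreme r w e)) c≡0
      ... | no ¬e = ⊥-elim (ℕP.1+n≢0 (trans (sym (countNonExtreme-nonExtreme r a w ¬e)) c≡0))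

    nonCorner-head : ∀ {d a} {w : Vec ℕ d} → 1 ℕ.≤ a → a ℕ.≤ k → InV d r w → NonCorner (a ∷ w)
    nonCorner-head {a = a} {w} 1≤a a≤k w∈V =
      ℕP.m≤n⇒m≤1+n a≤k ∷ᵛ w∈V ,
      λ c≡0 → ℕP.1+n≢0 (trans (sym (countNonExtreme-nonExtreme r a w (inner⇒¬Extreme 1≤a a≤k))) c≡0)

    midpoint-∷ : ∀ {d a} {w : Vec ℕ d} → a ℕ.≤ r → Midpoint w → Midpoint (a ∷ w)
    midpoint-∷ a≤r m = record
      { left     = _ ∷ left
      ; right    = _ ∷ right
      ; left∈    = nonCorner-∷ a≤r left∈
      ; right∈   = nonCorner-∷ a≤r right∈
      ; distinct = λ eq → distinct (VecP.∷-injectiveʳ eq)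
      ; sums     = λ { zero → refl ; (suc i) → sums i }
      }
      where open Midpoint m

    midpoint-±1 : ∀ {d} b (w : Vec ℕ d) → NonCorner (suc (suc b) ∷ w) → NonCorner (b ∷ w) →
                    Midpoint (suc b ∷ w)
    midpoint-±1 b w left∈ right∈ = record
      { left     = suc (suc b) ∷ w
      ; right    = b ∷ w
      ; left∈    = left∈
      ; right∈   = right∈
      ; distinct = λ eq → ℕP.<-irrefl (sym (VecP.∷-injectiveˡ eq)) (ℕP.n≤1+n (suc b))
      ; sums     = λ { zero → cong suc (sym (ℕP.+-suc b b)) ; (suc i) → refl }
      }

    extreme≤r : ∀ {a} → Extreme r a → a ℕ.≤ r
    extreme≤r (inj₁ refl) = z≤n
    extreme≤r (inj₂ refl) = ℕP.≤-refl

    vertexShape-∷ : ∀ {d a} {w : Vec ℕ d} → Extreme r a → VertexShape d r w → VertexShape (suc d) r (a ∷ w)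
    vertexShape-∷ {w = w} e ((w∈V , c≡1) , shape) =
      (extreme≤r e ∷ᵛ w∈V , trans (countNonExtreme-extreme r w e) c≡1) , inj₁ e ∷ᵛ shape

    vertexShape-head : ∀ {d a} {w : Vec ℕ d} → a ℕ.≤ r → ¬ Extreme r a → a ≡ 1 ⊎ a ≡ k →
                       VAll (Extreme r) w → VertexShape (suc d) r (a ∷ w)
    vertexShape-head {a = a} {w} a≤r ¬e a∈[1,k] es =
      (a≤r ∷ᵛ VAll.map extreme≤r es ,
       trans (countNonExtreme-nonExtreme r a w ¬e) (cong suc (allExtreme⇒countNonExtreme≡0 r es))) ,
      inj₂ a∈[1,k] ∷ᵛ VAll.map inj₁ es

    vertexShape-uncons : ∀ {d a} {w : Vec ℕ d} → VertexShape (suc d) r (a ∷ w) →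
                         (Extreme r a × VertexShape d r w) ⊎ ((a ≡ 1 ⊎ a ≡ k) × VAll (Extreme r) w)
    vertexShape-uncons {a = a} {w} ((_ ∷ᵛ w∈V , c≡1) , (entry ∷ᵛ shape)) with Extreme? r a
    ... | yes e = inj₁ (e , (w∈V , trans (sym (countNonExtreme-extreme r w e)) c≡1) , shape)
    ... | no ¬e with entry
    ...   | inj₁ e        = ⊥-elim (¬e e)
    ...   | inj₂ a∈[1,k] = inj₂ (a∈[1,k] , countNonExtreme≡0⇒allExtreme r w
                               (ℕP.suc-injective (trans (sym (countNonExtreme-nonExtreme r a w ¬e)) c≡1)))

    decompose-head : ∀ {d} a (w : Vec ℕ d) → 1 ℕ.≤ a → a ℕ.≤ k → InV d r w →
                     VertexShape (suc d) r (a ∷ w) ⊎ Midpoint (a ∷ w)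
    decompose-head (suc b) w 1≤a a≤k w∈V with countNonExtreme r w ℕ.≟ 0
    ... | no tail≢0 = inj₂ (midpoint-±1 b w (nonCorner-∷ (s≤s a≤k) (w∈V , tail≢0))
                                               (nonCorner-∷ (ℕP.m≤n⇒m≤1+n (ℕP.<⇒≤ a≤k))
                                                            (w∈V , tail≢0)))
    ... | yes tail≡0 = single-nonExtreme b 1≤a a≤k
      where
      es = countNonExtreme≡0⇒allExtreme r w tail≡0
      single-nonExtreme : ∀ b → 1 ℕ.≤ suc b → suc b ℕ.≤ k →
                          VertexShape _ r (suc b ∷ w) ⊎ Midpoint (suc b ∷ w)
      single-nonExtreme zero    1≤a a≤k =
        inj₁ (vertexShape-head (ℕP.m≤n⇒m≤1+n a≤k) (inner⇒¬Extreme 1≤a a≤k) (inj₁ refl) es)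
      single-nonExtreme (suc c) 1≤a a≤k with suc (suc c) ℕ.≟ k
      ... | yes a≡k = inj₁ (vertexShape-head (ℕP.m≤n⇒m≤1+n a≤k) (inner⇒¬Extreme 1≤a a≤k) (inj₂ a≡k) es)
      ... | no a≢k  = inj₂ (midpoint-±1 (suc c) w
                              (nonCorner-head (s≤s z≤n) (ℕP.≤∧≢⇒< a≤k a≢k) w∈V)
                              (nonCorner-head (s≤s z≤n) (ℕP.<⇒≤ a≤k) w∈V))

    decompose : ∀ {d} (w : Vec ℕ d) → NonCorner w → VertexShape d r w ⊎ Midpoint w
    decompose []      (_ , c≢0) = ⊥-elim (c≢0 refl)
    decompose (a ∷ w) (a≤r ∷ᵛ w∈V , c≢0) with Extreme? r a
    ... | yes e = Sum.map (vertexShape-∷ e) (midpoint-∷ a≤r)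
                    (decompose w (w∈V , λ c≡0 → c≢0 (trans (countNonExtreme-extreme r w e) c≡0)))
    ... | no ¬e = decompose-head a w (proj₁ bounds) (proj₂ bounds) w∈V
      where bounds = nonExtreme-bounds a≤r ¬e

    image⇒nonCorner : ∀ {d} {u : Vec ℕ d} → InImage k d r u → NonCorner u
    image⇒nonCorner {u = u} img = let (u∈V , u∉V₀) = Equivalence.to (inImage⇔V∖V₀ k u) img
                                  in u∈V , λ c≡0 → u∉V₀ (u∈V , c≡0)

    image-point : ∀ {d} {u : Vec ℕ d} → NonCorner u → ImageQ k d r (embed u)
    image-point {u = u} (u∈V , c≢0) =
      u , Equivalence.from (inImage⇔V∖V₀ k u) (u∈V , λ (_ , c≡0) → c≢0 c≡0) , refl

    midpoint⇒¬vertex : ∀ {d} {w : Vec ℕ d} → Midpoint w → ¬ IsVertex (ImageQ k d r) (embed w)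
    midpoint⇒¬vertex {w = w} m (_ , extreme) =
      distinct (embed-injective (extreme (embed left) (embed right) ½
        (member⇒InConv (image-point left∈)) (member⇒InConv (image-point right∈))
        (toWitness {a? = 0ℚ ℚP.<? ½} _) (toWitness {a? = ½ ℚP.<? 1ℚ} _) w≡))
      where
      open Midpoint m
      w≡ : embed w ≡ (½ ·Q embed left) +Q ((1ℚ - ½) ·Q embed right)
      w≡ = vecExt λ i → let lᵢ = lookup left i; rᵢ = lookup right i; wᵢ = lookup w i in begin
        lookup (embed w) i                                 ≡⟨ lookup-embed w i ⟩
        ℕtoℚ wᵢ                                            ≡⟨ solve 1 (λ x → x := con ½ :* (x :+ x)) refl (ℕtoℚ wᵢ) ⟩
        ½ * (ℕtoℚ wᵢ + ℕtoℚ wᵢ)                            ≡⟨ cong (½ *_) (ℕtoℚ-+ wᵢ wᵢ) ⟨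
        ½ * ℕtoℚ (wᵢ ℕ.+ wᵢ)                               ≡⟨ cong (λ n → ½ * ℕtoℚ n) (sums i) ⟨
        ½ * ℕtoℚ (lᵢ ℕ.+ rᵢ)                               ≡⟨ cong (½ *_) (ℕtoℚ-+ lᵢ rᵢ) ⟩
        ½ * (ℕtoℚ lᵢ + ℕtoℚ rᵢ)
          ≡⟨ solve 2 (λ x y → con ½ :* (x :+ y) := con ½ :* x :+ (con 1ℚ :- con ½) :* y) refl (ℕtoℚ lᵢ) (ℕtoℚ rᵢ) ⟩
        ½ * ℕtoℚ lᵢ + (1ℚ - ½) * ℕtoℚ rᵢ
          ≡⟨ cong₂ (λ x y → ½ * x + (1ℚ - ½) * y) (lookup-embed left i) (lookup-embed right i) ⟨
        ½ * lookup (embed left) i + (1ℚ - ½) * lookup (embed right) i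
          ≡⟨ lookup-combination ½ (1ℚ - ½) (embed left) (embed right) i ⟨
        lookup ((½ ·Q embed left) +Q ((1ℚ - ½) ·Q embed right)) i
          ∎
        where open ≡-Reasoning

    distance : End → ℕ → ℕ
    distance bottom a = a
    distance top    a = r ℕ.∸ a

    slope : End → ℚ
    slope bottom = 1ℚ
    slope top    = - 1ℚ

    offset : End → ℚ
    offset bottom = 0ℚ
    offset top    = ℕtoℚ r

    gap : End → ℚ → ℚ
    gap e x = slope e * x + offset e

    gap-ℕtoℚ : ∀ e {a} → a ℕ.≤ r → gap e (ℕtoℚ a) ≡ ℕtoℚ (distance e a)
    gap-ℕtoℚ bottom {a} _   = solve 1 (λ x → con 1ℚ :* x :+ con 0ℚ := x) refl (ℕtoℚ a)
    gap-ℕtoℚ top    {a} a≤r =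
      trans (solve 2 (λ x R → con (- 1ℚ) :* x :+ R := R :- x) refl (ℕtoℚ a) (ℕtoℚ r)) (sym (ℕtoℚ-∸ a≤r))

    gap-injective : ∀ e {x y} → gap e x ≡ gap e y → x ≡ y
    gap-injective bottom {x} {y} eq =
      trans (solve 1 (λ x → x := con 1ℚ :* x :+ con 0ℚ) refl x)
            (trans eq (solve 1 (λ y → con 1ℚ :* y :+ con 0ℚ := y) refl y))
    gap-injective top {x} {y} eq =
      trans (solve 2 (λ x R → x := con (- 1ℚ) :* (con (- 1ℚ) :* x :+ R :- R)) refl x (ℕtoℚ r))
            (trans (cong (λ z → - 1ℚ * (z - ℕtoℚ r)) eq)
                   (solve 2 (λ y R → con (- 1ℚ) :* (con (- 1ℚ) :* y :+ R :- R) := y) refl y (ℕtoℚ r)))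

    1≤distance : ∀ e {a} → 1 ℕ.≤ a → a ℕ.≤ k → 1 ℕ.≤ distance e a
    1≤distance bottom 1≤a _   = 1≤a
    1≤distance top    _   a≤k = ℕP.m<n⇒0<n∸m (s≤s a≤k)

    module Facets {d} (ends : Fin d → End) where

      facet : Fin d → Vec ℚ d → ℚ
      facet j x = slope (ends j) * lookup x j

      total : Vec ℚ d → ℚ
      total x = sum (λ j → facet j x)

      totalOffset : ℚ
      totalOffset = sum (λ j → offset (ends j)) - 1ℚ

      facet-isLinear : ∀ j → IsLinear (facet j)
      facet-isLinear j = *-isLinear (slope (ends j)) (lookup-isLinear j)

      total-isLinear : IsLinear total
      total-isLinear = sum-isLinear facet facet-isLinear

      total+offset : ∀ x → total x + totalOffset ≡ sum (λ j → gap (ends j) (lookup x j)) - 1ℚ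
      total+offset x =
        trans (solve 2 (λ a b → a :+ (b :- con 1ℚ) := a :+ b :- con 1ℚ) refl (total x) _)
              (cong (_- 1ℚ) (sym (∑-distrib-+ (λ j → facet j x) (λ j → offset (ends j)))))

      gap-embed : ∀ {u} → InV d r u → ∀ j → gap (ends j) (lookup (embed u) j) ≡ ℕtoℚ (distance (ends j) (lookup u j))
      gap-embed {u} u∈V j = trans (cong (gap (ends j)) (lookup-embed u j)) (gap-ℕtoℚ (ends j) (VAllP.lookup⁺ u∈V j))

      facet-valid : ∀ j p → ImageQ k d r p → 0ℚ ≤ facet j p + offset (ends j)
      facet-valid j _ (u , img , refl) =
        subst (0ℚ ≤_) (sym (gap-embed (proj₁ (image⇒nonCorner img)) j))
          (0≤ℕtoℚ (distance (ends j) (lookup u j)))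

      total-valid : ∀ p → ImageQ k d r p → 0ℚ ≤ total p + totalOffset
      total-valid _ (u , img , refl) = subst (0ℚ ≤_) (sym (total+offset (embed u))) 0≤gaps-1
        where
        u∈V = proj₁ (image⇒nonCorner img)
        gaps = λ j → gap (ends j) (lookup (embed u) j)
        i = proj₁ (nonExtreme-entry r u (proj₂ (image⇒nonCorner img)))
        bounds = nonExtreme-bounds (VAllP.lookup⁺ u∈V i) (proj₂ (nonExtreme-entry r u (proj₂ (image⇒nonCorner img))))
        1≤gapᵢ : 1ℚ ≤ gaps i
        1≤gapᵢ = subst (1ℚ ≤_) (sym (gap-embed u∈V i))
                   (ℕtoℚ-mono-≤ (1≤distance (ends i) (proj₁ bounds) (proj₂ bounds)))
        1≤gaps : 1ℚ ≤ sum gaps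
        1≤gaps = ℚP.≤-trans 1≤gapᵢ (term≤sum gaps (λ j → subst (0ℚ ≤_) (sym (gap-embed u∈V j))
                   (0≤ℕtoℚ (distance (ends j) (lookup u j)))) i)
        0≤gaps-1 : 0ℚ ≤ sum gaps - 1ℚ
        0≤gaps-1 = subst (_≤ sum gaps - 1ℚ) (ℚP.+-inverseʳ 1ℚ) (ℚP.+-monoˡ-≤ (- 1ℚ) 1≤gaps)

      pin : ∀ {x y} → (∀ j → gap (ends j) (lookup x j) ≡ gap (ends j) (lookup y j)) → x ≡ y
      pin same-gaps = vecExt λ j → gap-injective (ends j) (same-gaps j)

    end : ∀ {a} → Extreme r a ⊎ (a ≡ 1 ⊎ a ≡ k) → End
    end (inj₁ (inj₁ _)) = bottom
    end (inj₁ (inj₂ _)) = top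
    end (inj₂ (inj₁ _)) = bottom
    end (inj₂ (inj₂ _)) = top

    module _ (1≤k : 1 ℕ.≤ k) where

      distance-end-extreme : ∀ {a} (s : Extreme r a ⊎ (a ≡ 1 ⊎ a ≡ k)) → Extreme r a → distance (end s) a ≡ 0
      distance-end-extreme (inj₁ (inj₁ refl)) _ = refl
      distance-end-extreme (inj₁ (inj₂ refl)) _ = ℕP.n∸n≡0 r
      distance-end-extreme (inj₂ (inj₁ refl)) e = ⊥-elim (inner⇒¬Extreme ℕP.≤-refl 1≤k e)
      distance-end-extreme (inj₂ (inj₂ refl)) e = ⊥-elim (inner⇒¬Extreme 1≤k ℕP.≤-refl e)

      distance-end-inner : ∀ {a} (s : Extreme r a ⊎ (a ≡ 1 ⊎ a ≡ k)) → ¬ Extreme r a → distance (end s) a ≡ 1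
      distance-end-inner (inj₁ e)           ¬e = ⊥-elim (¬e e)
      distance-end-inner (inj₂ (inj₁ refl)) _  = refl
      distance-end-inner (inj₂ (inj₂ refl)) _  = ℕP.m+n∸n≡m 1 k

      vertexShape⇒vertex : ∀ {d} {w : Vec ℕ d} → VertexShape d r w → IsVertex (ImageQ k d r) (embed w)
      vertexShape⇒vertex {d} {w} ((w∈V , c≡1) , shape) =
        member⇒InConv (image-point (w∈V , λ c≡0 → ℕP.1+n≢0 (trans (sym c≡1) c≡0))) , same
        where
        ends = λ j → end (VAllP.lookup⁺ shape j)
        open Facets ends
        j₀ = proj₁ (unique-nonExtreme-entry r w c≡1)
        gapʷ = λ j → gap (ends j) (lookup (embed w) j)

        gapʷ-others : ∀ j → j ≢ j₀ → gapʷ j ≡ 0ℚ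
        gapʷ-others j j≢j₀ = trans (gap-embed w∈V j) (cong ℕtoℚ
          (distance-end-extreme (VAllP.lookup⁺ shape j) (proj₂ (proj₂ (unique-nonExtreme-entry r w c≡1)) j j≢j₀)))

        gapʷ-j₀ : gapʷ j₀ ≡ 1ℚ
        gapʷ-j₀ = trans (gap-embed w∈V j₀) (cong ℕtoℚ
          (distance-end-inner (VAllP.lookup⁺ shape j₀) (proj₁ (proj₂ (unique-nonExtreme-entry r w c≡1)))))

        gaps-sum : ∀ x → (∀ j → j ≢ j₀ → gap (ends j) (lookup x j) ≡ 0ℚ) →
                   total x + totalOffset ≡ gap (ends j₀) (lookup x j₀) - 1ℚ
        gaps-sum x others = trans (total+offset x) (cong (_- 1ℚ) (sum-single (λ j → gap (ends j) (lookup x j)) j₀ others))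

        total-w : total (embed w) + totalOffset ≡ 0ℚ
        total-w = trans (gaps-sum (embed w) gapʷ-others) (trans (cong (_- 1ℚ) gapʷ-j₀) (ℚP.+-inverseʳ 1ℚ))

        on-face : ∀ x → (∀ j → j ≢ j₀ → gap (ends j) (lookup x j) ≡ 0ℚ) → total x + totalOffset ≡ 0ℚ →
                  x ≡ embed w
        on-face x others total≡0 = pin same-gap
          where
          same-gap : ∀ j → gap (ends j) (lookup x j) ≡ gapʷ j
          same-gap j with j FinP.≟ j₀
          ... | no j≢j₀ = trans (others j j≢j₀) (sym (gapʷ-others j j≢j₀))
          ... | yes refl = trans
            (solve 1 (λ g → g := g :- con 1ℚ :+ con 1ℚ) refl (gap (ends j) (lookup x j)))
            (trans (cong (_+ 1ℚ) (trans (sym (gaps-sum x others)) total≡0)) (trans (ℚP.+-identityˡ 1ℚ) (sym gapʷ-j₀)))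

        same : ∀ a b t → InConv (ImageQ k d r) a → InConv (ImageQ k d r) b → 0ℚ < t → t < 1ℚ →
               embed w ≡ (t ·Q a) +Q ((1ℚ - t) ·Q b) → a ≡ b
        same a b t a∈ b∈ 0<t t<1 w≡ =
          trans (on-face a (λ j j≢j₀ → proj₁ (facet-face j j≢j₀)) (proj₁ total-face))
                (sym (on-face b (λ j j≢j₀ → proj₂ (facet-face j j≢j₀)) (proj₂ total-face)))
          where
          facet-face = λ j j≢j₀ → tight-face (facet-isLinear j) (offset (ends j)) (facet-valid j)
                                    a∈ b∈ 0<t t<1 w≡ (gapʷ-others j j≢j₀)
          total-face = tight-face total-isLinear totalOffset total-valid a∈ b∈ 0<t t<1 w≡ total-w

      vertex⇔vertexShape : ∀ {d} (v : Vec ℚ d) →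
        IsVertex (ImageQ k d r) v ⇔ (Σ (Vec ℕ d) λ w → VertexShape d r w × embed w ≡ v)
      vertex⇔vertexShape v = mk⇔ to (λ (w , shape , w≡v) → subst (IsVertex (ImageQ k _ r)) w≡v (vertexShape⇒vertex shape))
        where
        to : IsVertex (ImageQ k _ r) v → Σ (Vec ℕ _) λ w → VertexShape _ r w × embed w ≡ v
        to v-vertex with vertex⇒member v-vertex
        ... | w , img , w≡v with decompose w (image⇒nonCorner img)
        ...   | inj₁ shape = w , shape , w≡v
        ...   | inj₂ m     = ⊥-elim (midpoint⇒¬vertex m (subst (IsVertex (ImageQ k _ r)) (sym w≡v) v-vertex))

open Vertices

module Counting where

  open import Data.Nat using (_+_; _*_; _^_)
  open import Data.Nat.Solver using () renaming (module +-*-Solver to NatSolver)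
  open import Data.List.Membership.Propositional using (_∈_)
  open import Data.List.Membership.Propositional.Properties using (∈-++⁺ˡ; ∈-++⁺ʳ; ∈-++⁻; ∈-map⁺; ∈-map⁻)
  open import Data.List.Relation.Unary.Any using (here; there)
  open import Data.List.Relation.Unary.AllPairs using (AllPairs; []; _∷_)
  open import Data.List.Relation.Unary.Unique.Propositional using (Unique)
  import Data.List.Relation.Unary.Unique.Propositional.Properties as UniqueP
  open import Data.List.Relation.Binary.Disjoint.Propositional using (Disjoint)

  module _ {d : ℕ} where

    tagged : List (ℕ × List (Vec ℕ d)) → List (Vec ℕ (suc d))
    tagged = concatMap (λ (a , X) → map (a ∷_) X)

    length-tagged : ∀ bs → length (tagged bs) ≡ ∑[ b ∈ bs ] length (proj₂ b)
    length-tagged []             = refl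
    length-tagged ((a , X) ∷ bs) =
      trans (ListP.length-++ (map (a ∷_) X)) (cong₂ _+_ (ListP.length-map (a ∷_) X) (length-tagged bs))

    ∈-tagged⁺ : ∀ {bs a X w} → (a , X) ∈ bs → w ∈ X → (a ∷ w) ∈ tagged bs
    ∈-tagged⁺ {a = a} (here refl) w∈X = ∈-++⁺ˡ (∈-map⁺ (a ∷_) w∈X)
    ∈-tagged⁺ {bs = (b , Y) ∷ _} (there aX∈bs) w∈X = ∈-++⁺ʳ (map (b ∷_) Y) (∈-tagged⁺ aX∈bs w∈X)

    ∈-tagged⁻ : ∀ bs {a w} → (a ∷ w) ∈ tagged bs → Σ (List (Vec ℕ d)) λ X → (a , X) ∈ bs × w ∈ X
    ∈-tagged⁻ ((b , Y) ∷ bs) aw∈ with ∈-++⁻ (map (b ∷_) Y) aw∈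
    ... | inj₂ aw∈rest = let (X , aX∈bs , w∈X) = ∈-tagged⁻ bs aw∈rest in X , there aX∈bs , w∈X
    ... | inj₁ aw∈bY with ∈-map⁻ (b ∷_) aw∈bY
    ...   | _ , w∈Y , refl = Y , here refl , w∈Y

    unique-tagged : ∀ bs → AllPairs (λ b c → proj₁ b ≢ proj₁ c) bs → All (λ b → Unique (proj₂ b)) bs →
                    Unique (tagged bs)
    unique-tagged []             []                  []         = []
    unique-tagged ((a , X) ∷ bs) (a≢tags ∷ distinct) (uX ∷ us) =
      UniqueP.++⁺ (UniqueP.map⁺ VecP.∷-injectiveʳ uX) (unique-tagged bs distinct us) disjoint
      where
      disjoint : Disjoint (map (a ∷_) X) (tagged bs)
      disjoint (v∈aX , v∈rest) with ∈-map⁻ (a ∷_) v∈aX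
      ... | _ , _ , refl = let (_ , aY∈bs , _) = ∈-tagged⁻ bs v∈rest in All.lookup a≢tags aY∈bs refl

  module _ (k : ℕ) (2≤k : 2 ℕ.≤ k) where
    open Polytope k

    1≤k : 1 ℕ.≤ k
    1≤k = ℕP.<⇒≤ 2≤k

    corners : ∀ d → List (Vec ℕ d)
    cornerBlocks : ∀ d → List (ℕ × List (Vec ℕ d))

    corners zero    = [] ∷ []
    corners (suc d) = tagged (cornerBlocks d)

    cornerBlocks d = (0 , corners d) ∷ (r , corners d) ∷ []

    shapes : ∀ d → List (Vec ℕ d)
    shapeBlocks : ∀ d → List (ℕ × List (Vec ℕ d))

    shapes zero    = []
    shapes (suc d) = tagged (shapeBlocks d)

    shapeBlocks d = (0 , shapes d) ∷ (r , shapes d) ∷ (1 , corners d) ∷ (k , corners d) ∷ []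

    length-corners : ∀ d → length (corners d) ≡ 2 ^ d
    length-corners zero    = refl
    length-corners (suc d) = trans (length-tagged (cornerBlocks d))
                                   (cong (λ c → c + (c + 0)) (length-corners d))

    length-shapes : ∀ d → length (shapes d) ≡ d * 2 ^ d
    length-shapes zero    = refl
    length-shapes (suc d) = begin
      length (shapes (suc d))
        ≡⟨ length-tagged (shapeBlocks d) ⟩
      s + (s + (c + (c + 0)))
        ≡⟨ cong₂ (λ s c → s + (s + (c + (c + 0)))) (length-shapes d) (length-corners d) ⟩
      d * 2 ^ d + (d * 2 ^ d + (2 ^ d + (2 ^ d + 0)))
        ≡⟨ NatSolver.solve 2 (λ d c → d :* c :+ (d :* c :+ (c :+ (c :+ con 0))) := (con 1 :+ d) :* (c :+ (c :+ con 0)))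
                           refl d (2 ^ d) ⟩
      suc d * 2 ^ suc d
        ∎
      where
      open ≡-Reasoning
      open NatSolver using (_:*_; _:+_; _:=_; con)
      s = length (shapes d)
      c = length (corners d)

    unique-corners : ∀ d → Unique (corners d)
    unique-corners zero    = [] ∷ []
    unique-corners (suc d) =
      unique-tagged (cornerBlocks d) (((λ ()) ∷ []) ∷ [] ∷ []) (unique-corners d ∷ unique-corners d ∷ [])

    unique-shapes : ∀ d → Unique (shapes d)
    unique-shapes zero    = []
    unique-shapes (suc d) = unique-tagged (shapeBlocks d)
      ( ((λ ()) ∷ (λ ()) ∷ ℕP.<⇒≢ (ℕP.<-trans ℕP.0<1+n 2≤k) ∷ [])
      ∷ (ℕP.>⇒≢ (s≤s 1≤k) ∷ ℕP.>⇒≢ (ℕP.n<1+n k) ∷ [])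
      ∷ (ℕP.<⇒≢ 2≤k ∷ [])
      ∷ [] ∷ [])
      (unique-shapes d ∷ unique-shapes d ∷ unique-corners d ∷ unique-corners d ∷ [])

    corners⁻ : ∀ {d} {w : Vec ℕ d} → w ∈ corners d → VAll (Extreme r) w
    corners⁻ {zero}  {[]}    _  = []ᵛ
    corners⁻ {suc d} {a ∷ w} w∈ with ∈-tagged⁻ (cornerBlocks d) w∈
    ... | _ , here refl , w∈X         = inj₁ refl ∷ᵛ corners⁻ w∈X
    ... | _ , there (here refl) , w∈X = inj₂ refl ∷ᵛ corners⁻ w∈X

    corners⁺ : ∀ {d} {w : Vec ℕ d} → VAll (Extreme r) w → w ∈ corners d
    corners⁺ []ᵛ                       = here refl
    corners⁺ {suc d} (inj₁ refl ∷ᵛ es) = ∈-tagged⁺ {bs = cornerBlocks d} (here refl) (corners⁺ es)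
    corners⁺ {suc d} (inj₂ refl ∷ᵛ es) = ∈-tagged⁺ {bs = cornerBlocks d} (there (here refl)) (corners⁺ es)

    shapes⁻ : ∀ {d} {w : Vec ℕ d} → w ∈ shapes d → VertexShape d r w
    shapes⁻ {suc d} {a ∷ w} w∈
      with ∈-tagged⁻ (shapeBlocks d) w∈
    ... | _ , here refl , w∈X                         = vertexShape-∷ (inj₁ refl) (shapes⁻ w∈X)
    ... | _ , there (here refl) , w∈X                 = vertexShape-∷ (inj₂ refl) (shapes⁻ w∈X)
    ... | _ , there (there (here refl)) , w∈X         =
      vertexShape-head (s≤s z≤n) (inner⇒¬Extreme ℕP.≤-refl 1≤k) (inj₁ refl) (corners⁻ w∈X)
    ... | _ , there (there (there (here refl))) , w∈X =
      vertexShape-head (ℕP.n≤1+n k) (inner⇒¬Extreme 1≤k ℕP.≤-refl) (inj₂ refl) (corners⁻ w∈X)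

    shapes⁺ : ∀ {d} {w : Vec ℕ d} → VertexShape d r w → w ∈ shapes d
    shapes⁺ {zero} {[]} ((_ , ()) , _)
    shapes⁺ {suc d} {a ∷ w} shape with vertexShape-uncons shape
    ... | inj₁ (inj₁ refl , s)  = ∈-tagged⁺ {bs = shapeBlocks d} (here refl) (shapes⁺ s)
    ... | inj₁ (inj₂ refl , s)  = ∈-tagged⁺ {bs = shapeBlocks d} (there (here refl)) (shapes⁺ s)
    ... | inj₂ (inj₁ refl , es) = ∈-tagged⁺ {bs = shapeBlocks d} (there (there (here refl))) (corners⁺ es)
    ... | inj₂ (inj₂ refl , es) = ∈-tagged⁺ {bs = shapeBlocks d} (there (there (there (here refl)))) (corners⁺ es)

    vertexCount : ∀ d → uEq k r d (d * 2 ^ d)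
    vertexCount d =
      map embed (shapes d) , UniqueP.map⁺ embed-injective (unique-shapes d) ,
      (λ v → mk⇔ (listed⇒vertex v) (vertex⇒listed v)) ,
      trans (ListP.length-map embed (shapes d)) (length-shapes d)
      where
      listed⇒vertex : ∀ v → v ∈ map embed (shapes d) → IsVertex (ImageQ k d r) v
      listed⇒vertex v v∈ with ∈-map⁻ embed v∈
      ... | w , w∈ , v≡w = Equivalence.from (vertex⇔vertexShape 1≤k v) (w , shapes⁻ w∈ , sym v≡w)
      vertex⇒listed : ∀ v → IsVertex (ImageQ k d r) v → v ∈ map embed (shapes d)
      vertex⇒listed v v-vertex with Equivalence.to (vertex⇔vertexShape 1≤k v) v-vertex
      ... | w , shape , w≡v = subst (_∈ map embed (shapes d)) w≡v (∈-map⁺ embed (shapes⁺ shape))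

open Counting

open import Data.Nat using (_≤_; _*_; _^_)
open import Data.Rational using (ℚ)

lemma4p5 : (d k : ℕ) → 1 ≤ d → 2 ≤ k →
    ((v : Vec ℕ d) → InImage k d (suc k) v ⇔ (InV d (suc k) v × ¬ InVi d (suc k) 0 v)) ×
    ((v : Vec ℚ d) → IsVertex (ImageQ k d (suc k)) v ⇔ (Σ (Vec ℕ d) λ w → VertexShape d (suc k) w × embed w ≡ v)) ×
    uEq k (suc k) d (d * 2 ^ d)
lemma4p5 d k _ 2≤k =
  inImage⇔V∖V₀ k ,
  Polytope.vertex⇔vertexShape k (ℕP.<⇒≤ 2≤k) ,
  vertexCount k 2≤k d
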